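{- Let $\{P_n(x)\}_{n\ge 1}$, $a_i(n)$, $r_i(n)$, $s_i(n)$ be as defined in the context and $m=\lfloor\frac{n-1}{2}\rfloor$. For every even $n\ge4$ and $0\le i\le m$, $a_i(n)\equiv r_i(n)\pmod 2$; for every odd $n\ge3$ and $0\le i\le m$, $a_i(n)\equiv s_i(n)\pmod 2$.
   Context: The sequence $\{P_n(x)\}_{n\ge1}$ of rational functions of $x$ is defined by $P_1=P_2=1$ and, for $n\ge 2$: if $n$ is odd, $4(2x+n)P_{n+1}(x)=2(x+n)P_n(x)+(2x+n)P_n(x+1)+(4x+n)\ell_n(x)$; if $n$ is even, $4P_{n+1}(x)=4(x+n)P_n(x)+2(2x+n+1)P_n(x+1)+(4x+n)\ell_{n-1}(x)$. Here for odd $r\ge1$, $\ell_r(x)=\prod_{j=1}^{(r-1)/2}(x+j)$ (the empty product equals $1$). Each $P_n$ is a polynomial of degree $m=\lfloor\frac{n-1}{2}\rfloor$ with integer coefficients; write $P_n(x)=\sum_{i=0}^{m}a_i(n)x^{m-i}$. For even $n\ge4$, $r_i(n)=\frac12[x^{m-i}]\Big((4x+3n-4)\prod_{j=0}^{(n-4)/2}(x+j)\Big)$, and for odd $n\ge3$, $s_i(n)=[x^{m-i}]\Big((4x+3n-4)\prod_{j=0}^{(n-3)/2}(x+j)\Big)$, where $[x^t]F$ denotes the coefficient of $x^t$ in the polynomial $F$. -}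

module Defs where

open import Data.Bool using (Bool; true; false; if_then_else_; not)
open import Data.Nat as ℕ using (ℕ; zero; suc; ⌊_/2⌋)
open import Data.Integer using (ℤ; +_)
open import Data.Rational using (ℚ; _/_; 0ℚ; 1ℚ; _+_; _*_; _-_)
open import Data.List using (List; []; _∷_)
open import Data.Product using (_×_; _,_; proj₁; Σ)
open import Relation.Binary.PropositionalEquality using (_≡_)
import Data.Integer as ℤ

-- Polynomials over ℚ as coefficient lists, lowest degree first
-- (trailing zeros allowed; missing coefficients are 0).
Poly : Set
Poly = List ℚ

q : ℕ → ℚ
q n = + n / 1

coeff : Poly → ℕ → ℚ
coeff []       _       = 0ℚ
coeff (a ∷ p)  zero    = a
coeff (a ∷ p)  (suc k) = coeff p k

padd : Poly → Poly → Poly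
padd []      p       = p
padd p       []      = p
padd (a ∷ p) (b ∷ r) = (a + b) ∷ padd p r

pscale : ℚ → Poly → Poly
pscale c []      = []
pscale c (a ∷ p) = (c * a) ∷ pscale c p

pshift : Poly → Poly
pshift p = 0ℚ ∷ p

pmulLin : ℚ → ℚ → Poly → Poly
pmulLin α β p = padd (pscale α (pshift p)) (pscale β p)

-- p(x+1)  (Horner: a + x q(x)  ↦  a + (x+1) q(x+1))
pshift1 : Poly → Poly
pshift1 []      = []
pshift1 (a ∷ p) = padd (a ∷ []) (pmulLin 1ℚ 1ℚ (pshift1 p))

-- synthetic division by (x + c): returns (quotient , remainder)
pdivLin' : ℚ → Poly → Poly × ℚ
pdivLin' c []      = [] , 0ℚ
pdivLin' c (a ∷ p) with pdivLin' c p
... | (qt , r) = (r ∷ qt) , (a - c * r)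

-- quotient of p by (x + c)  (exact in all uses below)
pdivLin : ℚ → Poly → Poly
pdivLin c p = proj₁ (pdivLin' c p)

prodFrom : ℕ → ℕ → Poly
prodFrom a zero    = 1ℚ ∷ []
prodFrom a (suc k) = pmulLin 1ℚ (q a) (prodFrom (suc a) k)

ell : ℕ → Poly
ell r = prodFrom 1 ⌊ ℕ.pred r /2⌋

isOdd : ℕ → Bool
isOdd zero    = false
isOdd (suc n) = not (isOdd n)

lin : ℚ → ℚ → Poly
lin α β = β ∷ α ∷ []

-- one step of the recurrence, computing P_{n+1} from P_n (n ≥ 2)
step : ℕ → Poly → Poly
step n p =
  if isOdd n
  then -- 4(2x+n) P_{n+1} = 2(x+n)P_n(x) + (2x+n)P_n(x+1) + (4x+n) ℓ_n(x)
       -- and 4(2x+n) = 8 (x + n/2)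
       pscale (+ 1 / 8)
         (pdivLin (+ n / 2)
           (padd (pmulLin (q 2) (q (2 ℕ.* n)) p)
           (padd (pmulLin (q 2) (q n) (pshift1 p))
                 (pmulLin (q 4) (q n) (ell n)))))
  else -- 4P_{n+1} = 4(x+n)P_n(x) + 2(2x+n+1)P_n(x+1) + (4x+n) ℓ_{n-1}(x)
       pscale (+ 1 / 4)
         (padd (pmulLin (q 4) (q (4 ℕ.* n)) p)
         (padd (pmulLin (q 4) (q (2 ℕ.* (suc n))) (pshift1 p))
               (pmulLin (q 4) (q n) (ell (ℕ.pred n)))))

-- P n = P_n  (P 0 is an unused dummy)
P : ℕ → Poly
P zero                = 1ℚ ∷ []
P (suc zero)          = 1ℚ ∷ []
P (suc (suc zero))    = 1ℚ ∷ []
P (suc (suc (suc k))) = step (suc (suc k)) (P (suc (suc k)))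

mOf : ℕ → ℕ
mOf n = ⌊ ℕ.pred n /2⌋

a : ℕ → ℕ → ℚ
a i n = coeff (P n) (mOf n ℕ.∸ i)

r : ℕ → ℕ → ℚ
r i n = (+ 1 / 2) * coeff (pmulLin (q 4) (q (3 ℕ.* n ℕ.∸ 4))
                             (prodFrom 0 (suc ⌊ n ℕ.∸ 4 /2⌋)))
                          (mOf n ℕ.∸ i)

s : ℕ → ℕ → ℚ
s i n = coeff (pmulLin (q 4) (q (3 ℕ.* n ℕ.∸ 4))
                (prodFrom 0 (suc ⌊ n ℕ.∸ 3 /2⌋)))
              (mOf n ℕ.∸ i)

_≡₂_ : ℚ → ℚ → Set
x ≡₂ y = Σ ℤ (λ k → x - y ≡ (+ 2 ℤ.* k) / 1)

{-# OPTIONS --safe #-}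
-- Write e_t = x(x+1)⋯(x+t-1). Then P_{2K} = ∑_{t+u=K-1} 4ᵘ u! binom(t+2u+1, t) e_t and
-- P_{2K+1} = 2(x + 2K) P_{2K} + e_K, by induction on n: expanded in the rising factorials with
-- base points 0 and 1, which the shift x ↦ x + 1 exchanges, each step of the recurrence (including
-- the exact division by 2x + n) becomes a linear relation between neighbouring coefficients, and all
-- of these follow from the absorption identities for binomial coefficients. Every e_t has integer
-- coefficients, and every coefficient of P_{2K} except the top one, K, carries a factor 4; hence
-- P_{2K} ≡ K e_{K-1} and P_{2K+1} ≡ e_K modulo 2, which is also what r and s reduce to.
module Submission where

open import Algebra.Properties.Group using (x∙y⁻¹≈ε⇒x≈y)
open import Data.Bool using (false; if_then_else_; not)
open import Data.Bool.Properties using (not-involutive)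
open import Data.Integer as ℤ using (ℤ; +_)
import Data.Integer.Properties as ℤP
import Data.Integer.Tactic.RingSolver as ℤSolver
open import Data.List using ([]; _∷_; length)
open import Data.Maybe using (just; nothing)
open import Data.Nat as ℕ using (ℕ; zero; suc; _≤_; _<_; _^_; _!; _⊔_; s≤s; z≤n; ⌊_/2⌋)
open import Data.Nat.Combinatorics using (_C_; nCk+nC[k+1]≡[n+1]C[k+1]; nC1≡n; k>n⇒nCk≡0; nCk≡nC[n∸k])
import Data.Nat.Properties as ℕP
import Data.Nat.Tactic.RingSolver as ℕSolver
open import Data.Product using (Σ; _,_; _×_; proj₁; proj₂)
open import Data.Rational as ℚ using (ℚ; 0ℚ; 1ℚ; _+_; _*_; _-_; -_; _/_; toℚᵘ)
import Data.Rational.Properties as ℚP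
import Data.Rational.Unnormalised as ℚᵘ
import Data.Rational.Unnormalised.Properties as ℚᵘP
open import Function using (_∘_; case_of_)
open import Level using (0ℓ)
open import Relation.Binary.Bundles using (Setoid)
open import Relation.Binary.PropositionalEquality
import Relation.Binary.Reasoning.Setoid as SetoidReasoning
open import Relation.Nullary using (yes; no)
open import Tactic.RingSolver.Core.Expression using (Κ; ⊝_) renaming (_⊕_ to _:+_; _⊗_ to _:*_)
import Tactic.RingSolver.NonReflective as NonReflective
open import Tactic.RingSolver.Core.AlmostCommutativeRing using (AlmostCommutativeRing; fromCommutativeRing)

open import Defs


ℚ-ring : AlmostCommutativeRing 0ℓ 0ℓ
ℚ-ring = fromCommutativeRing ℚP.+-*-commutativeRing λ x →
  case x ℚP.≟ 0ℚ of λ { (yes x≡0) → just (sym x≡0) ; (no _) → nothing }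

open NonReflective ℚ-ring using (solve; _⊜_)

-- Proofs by linear combination: x ≡ y follows from an equation l ≡ r, itself a weighted sum
-- c₁ ⊙ h₁ ⊕ c₂ ⊙ h₂ ⊕ ⋯ of hypotheses, once x - y ≡ l - r is checked by the ring solver. The local
-- lemmas `identity` state such checks; their proofs repeat the statement in the solver's syntax.
infixl 4 _⊕_
infix 5 _⊙_

_⊙_ : ∀ c {l r} → l ≡ r → c * l ≡ c * r
c ⊙ l≡r = cong (c *_) l≡r

_⊕_ : ∀ {l₁ r₁ l₂ r₂} → l₁ ≡ r₁ → l₂ ≡ r₂ → l₁ + l₂ ≡ r₁ + r₂
_⊕_ = cong₂ _+_

combine : ∀ {x y l r} → l ≡ r → x - y ≡ l - r → x ≡ y
combine {x} {y} {l} refl x-y≡l-l = x∙y⁻¹≈ε⇒x≈y ℚP.+-0-group x y (trans x-y≡l-l (ℚP.+-inverseʳ l))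

-- `q n` of Defs is ι (+ n) by definition.
ι : ℤ → ℚ
ι z = z / 1

private
  toℚᵘ-ι : ∀ z → toℚᵘ (ι z) ℚᵘ.≃ ℚᵘ.mkℚᵘ z 0
  toℚᵘ-ι z = ℚP.toℚᵘ-fromℚᵘ (ℚᵘ.mkℚᵘ z 0)

ι-+ : ∀ a b → ι (a ℤ.+ b) ≡ ι a + ι b
ι-+ a b = ℚP.toℚᵘ-injective (begin
  toℚᵘ (ι (a ℤ.+ b))                           ≈⟨ toℚᵘ-ι (a ℤ.+ b) ⟩
  ℚᵘ.mkℚᵘ (a ℤ.+ b) 0                          ≈⟨ ℚᵘ.*≡* (distrib a b) ⟩
  ℚᵘ.mkℚᵘ a 0 ℚᵘ.+ ℚᵘ.mkℚᵘ b 0                 ≈⟨ ℚᵘP.+-cong (toℚᵘ-ι a) (toℚᵘ-ι b) ⟨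
  toℚᵘ (ι a) ℚᵘ.+ toℚᵘ (ι b)                   ≈⟨ ℚP.toℚᵘ-homo-+ (ι a) (ι b) ⟨
  toℚᵘ (ι a + ι b)                             ∎)
  where
  open SetoidReasoning ℚᵘP.≃-setoid
  distrib : ∀ a b → (a ℤ.+ b) ℤ.* (+ 1 ℤ.* + 1) ≡ (a ℤ.* + 1 ℤ.+ b ℤ.* + 1) ℤ.* + 1
  distrib = ℤSolver.solve-∀

ι-* : ∀ a b → ι (a ℤ.* b) ≡ ι a * ι b
ι-* a b = ℚP.toℚᵘ-injective (begin
  toℚᵘ (ι (a ℤ.* b))                           ≈⟨ toℚᵘ-ι (a ℤ.* b) ⟩
  ℚᵘ.mkℚᵘ (a ℤ.* b) 0                          ≈⟨ ℚᵘ.*≡* (assoc a b) ⟩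
  ℚᵘ.mkℚᵘ a 0 ℚᵘ.* ℚᵘ.mkℚᵘ b 0                 ≈⟨ ℚᵘP.*-cong (toℚᵘ-ι a) (toℚᵘ-ι b) ⟨
  toℚᵘ (ι a) ℚᵘ.* toℚᵘ (ι b)                   ≈⟨ ℚP.toℚᵘ-homo-* (ι a) (ι b) ⟨
  toℚᵘ (ι a * ι b)                             ∎)
  where
  open SetoidReasoning ℚᵘP.≃-setoid
  assoc : ∀ a b → (a ℤ.* b) ℤ.* (+ 1 ℤ.* + 1) ≡ (a ℤ.* b) ℤ.* + 1
  assoc = ℤSolver.solve-∀

q-half : ∀ n → + n / 2 ≡ q n * (+ 1 / 2)
q-half n = ℚP.toℚᵘ-injective (begin
  toℚᵘ (+ n / 2)                          ≈⟨ ℚP.toℚᵘ-fromℚᵘ (ℚᵘ.mkℚᵘ (+ n) 1) ⟩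
  ℚᵘ.mkℚᵘ (+ n) 1                         ≈⟨ ℚᵘ.*≡* (assoc (+ n)) ⟩
  ℚᵘ.mkℚᵘ (+ n) 0 ℚᵘ.* ℚᵘ.mkℚᵘ (+ 1) 1    ≈⟨ ℚᵘP.*-cong (toℚᵘ-ι (+ n)) (ℚP.toℚᵘ-fromℚᵘ (ℚᵘ.mkℚᵘ (+ 1) 1)) ⟨
  toℚᵘ (q n) ℚᵘ.* toℚᵘ (+ 1 / 2)          ≈⟨ ℚP.toℚᵘ-homo-* (q n) (+ 1 / 2) ⟨
  toℚᵘ (q n * (+ 1 / 2))                  ∎)
  where
  open SetoidReasoning ℚᵘP.≃-setoid
  assoc : ∀ z → z ℤ.* (+ 1 ℤ.* + 2) ≡ (z ℤ.* + 1) ℤ.* + 2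
  assoc = ℤSolver.solve-∀

q-+ : ∀ m n → q (m ℕ.+ n) ≡ q m + q n
q-+ m n = trans (cong ι (ℤP.pos-+ m n)) (ι-+ (+ m) (+ n))

q-* : ∀ m n → q (m ℕ.* n) ≡ q m * q n
q-* m n = trans (cong ι (ℤP.pos-* m n)) (ι-* (+ m) (+ n))

q-suc : ∀ n → q (suc n) ≡ 1ℚ + q n
q-suc = q-+ 1

q-cancelˡ : ∀ m {x y} → q (suc m) * x ≡ q (suc m) * y → x ≡ y
q-cancelˡ m eq = ℚP.≤-antisym (cancel (ℚP.≤-reflexive eq)) (cancel (ℚP.≤-reflexive (sym eq)))
  where
  instance
    q-pos : ℚ.Positive (q (suc m))
    q-pos = ℚP.normalize-pos (suc m) 1
  cancel : ∀ {x y} → q (suc m) * x ℚ.≤ q (suc m) * y → x ℚ.≤ y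
  cancel = ℚP.*-cancelˡ-≤-pos (q (suc m))

-- Polynomials up to trailing zeros

infix 4 _≈_
record _≈_ (p r : Poly) : Set where
  constructor coeffwise
  field coeff-≡ : ∀ j → coeff p j ≡ coeff r j
open _≈_

≈-setoid : Setoid 0ℓ 0ℓ
≈-setoid = record
  { Carrier = Poly
  ; _≈_ = _≈_
  ; isEquivalence = record
    { refl = coeffwise λ _ → refl
    ; sym = λ p≈r → coeffwise λ j → sym (coeff-≡ p≈r j)
    ; trans = λ p≈r r≈s → coeffwise λ j → trans (coeff-≡ p≈r j) (coeff-≡ r≈s j)
    }
  }

open Setoid ≈-setoid using () renaming (refl to ≈-refl; sym to ≈-sym; trans to ≈-trans)
module ≈-Reasoning = SetoidReasoning ≈-setoid

≡⇒≈ : ∀ {p r} → p ≡ r → p ≈ r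
≡⇒≈ refl = ≈-refl

coeff-padd : ∀ p r j → coeff (padd p r) j ≡ coeff p j + coeff r j
coeff-padd []      r       j       = sym (ℚP.+-identityˡ _)
coeff-padd (a ∷ p) []      j       = sym (ℚP.+-identityʳ _)
coeff-padd (a ∷ p) (b ∷ r) zero    = refl
coeff-padd (a ∷ p) (b ∷ r) (suc j) = coeff-padd p r j

coeff-pscale : ∀ c p j → coeff (pscale c p) j ≡ c * coeff p j
coeff-pscale c []      j       = sym (ℚP.*-zeroʳ c)
coeff-pscale c (a ∷ p) zero    = refl
coeff-pscale c (a ∷ p) (suc j) = coeff-pscale c p j

coeff-pmulLin : ∀ α β p j → coeff (pmulLin α β p) j ≡ α * coeff (0ℚ ∷ p) j + β * coeff p j
coeff-pmulLin α β p j = trans (coeff-padd (pscale α (0ℚ ∷ p)) (pscale β p) j)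
  (cong₂ _+_ (coeff-pscale α (0ℚ ∷ p) j) (coeff-pscale β p j))

padd-cong : ∀ {p p′ r r′} → p ≈ p′ → r ≈ r′ → padd p r ≈ padd p′ r′
padd-cong {p} {p′} {r} {r′} p≈p′ r≈r′ = coeffwise λ j → begin
  coeff (padd p r) j       ≡⟨ coeff-padd p r j ⟩
  coeff p j + coeff r j    ≡⟨ cong₂ _+_ (coeff-≡ p≈p′ j) (coeff-≡ r≈r′ j) ⟩
  coeff p′ j + coeff r′ j  ≡⟨ coeff-padd p′ r′ j ⟨
  coeff (padd p′ r′) j     ∎
  where open ≡-Reasoning

pscale-cong : ∀ c {p p′} → p ≈ p′ → pscale c p ≈ pscale c p′
pscale-cong c {p} {p′} p≈p′ = coeffwise λ j → begin
  coeff (pscale c p) j   ≡⟨ coeff-pscale c p j ⟩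
  c * coeff p j          ≡⟨ cong (c *_) (coeff-≡ p≈p′ j) ⟩
  c * coeff p′ j         ≡⟨ coeff-pscale c p′ j ⟨
  coeff (pscale c p′) j  ∎
  where open ≡-Reasoning

≈-tail : ∀ {a b p r} → (a ∷ p) ≈ (b ∷ r) → p ≈ r
≈-tail a∷p≈b∷r = coeffwise λ j → coeff-≡ a∷p≈b∷r (suc j)

≈[]-tail : ∀ {a p} → (a ∷ p) ≈ [] → p ≈ []
≈[]-tail a∷p≈[] = coeffwise λ j → coeff-≡ a∷p≈[] (suc j)

padd-congʳ : ∀ p {r r′} → r ≈ r′ → padd p r ≈ padd p r′
padd-congʳ p = padd-cong (≈-refl {p})

pscale-identityˡ : ∀ p → pscale 1ℚ p ≈ p
pscale-identityˡ p = coeffwise λ j → trans (coeff-pscale 1ℚ p j) (ℚP.*-identityˡ (coeff p j))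

shift-cong : ∀ {p p′} → p ≈ p′ → (0ℚ ∷ p) ≈ (0ℚ ∷ p′)
shift-cong p≈p′ = coeffwise λ { zero → refl ; (suc j) → coeff-≡ p≈p′ j }

pmulLin-cong : ∀ α β {p p′} → p ≈ p′ → pmulLin α β p ≈ pmulLin α β p′
pmulLin-cong α β p≈p′ = padd-cong (pscale-cong α (shift-cong p≈p′)) (pscale-cong β p≈p′)

padd-identityʳ : ∀ p → padd p [] ≈ p
padd-identityʳ []      = ≈-refl
padd-identityʳ (a ∷ p) = ≈-refl

padd-zeroˡ : ∀ p → padd (0ℚ ∷ []) p ≈ p
padd-zeroˡ []      = coeffwise λ { zero → refl ; (suc j) → refl }
padd-zeroˡ (a ∷ p) = coeffwise λ { zero → ℚP.+-identityˡ a ; (suc j) → refl }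

padd-interchange : ∀ a b c d → padd (padd a b) (padd c d) ≈ padd (padd a c) (padd b d)
padd-interchange a b c d = coeffwise λ j → begin
  coeff (padd (padd a b) (padd c d)) j
    ≡⟨ trans (coeff-padd (padd a b) (padd c d) j) (cong₂ _+_ (coeff-padd a b j) (coeff-padd c d j)) ⟩
  (coeff a j + coeff b j) + (coeff c j + coeff d j)
    ≡⟨ interchange (coeff a j) (coeff b j) (coeff c j) (coeff d j) ⟩
  (coeff a j + coeff c j) + (coeff b j + coeff d j)
    ≡⟨ sym (trans (coeff-padd (padd a c) (padd b d) j) (cong₂ _+_ (coeff-padd a c j) (coeff-padd b d j))) ⟩
  coeff (padd (padd a c) (padd b d)) j ∎
  where
  open ≡-Reasoning
  interchange : ∀ w x y z → (w + x) + (y + z) ≡ (w + y) + (x + z)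
  interchange = solve 4 (λ w x y z → (w :+ x :+ (y :+ z)) ⊜ (w :+ y :+ (x :+ z))) refl

coeff-padd₃ : ∀ a b c j → coeff (padd a (padd b c)) j ≡ coeff a j + (coeff b j + coeff c j)
coeff-padd₃ a b c j = trans (coeff-padd a (padd b c) j) (cong (_+_ (coeff a j)) (coeff-padd b c j))

coeff-shift-pscale : ∀ c p j → coeff (0ℚ ∷ pscale c p) j ≡ c * coeff (0ℚ ∷ p) j
coeff-shift-pscale c p zero    = sym (ℚP.*-zeroʳ c)
coeff-shift-pscale c p (suc j) = coeff-pscale c p j

pmulLin-padd : ∀ α β p r → pmulLin α β (padd p r) ≈ padd (pmulLin α β p) (pmulLin α β r)
pmulLin-padd α β p r = coeffwise λ j → begin
  coeff (pmulLin α β (padd p r)) j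
    ≡⟨ coeff-pmulLin α β (padd p r) j ⟩
  α * coeff (0ℚ ∷ padd p r) j + β * coeff (padd p r) j
    ≡⟨ cong₂ (λ u v → α * u + β * v) (coeff-padd (0ℚ ∷ p) (0ℚ ∷ r) j) (coeff-padd p r j) ⟩
  α * (coeff (0ℚ ∷ p) j + coeff (0ℚ ∷ r) j) + β * (coeff p j + coeff r j)
    ≡⟨ distrib α β (coeff (0ℚ ∷ p) j) (coeff (0ℚ ∷ r) j) (coeff p j) (coeff r j) ⟩
  (α * coeff (0ℚ ∷ p) j + β * coeff p j) + (α * coeff (0ℚ ∷ r) j + β * coeff r j)
    ≡⟨ sym (trans (coeff-padd (pmulLin α β p) (pmulLin α β r) j)
                  (cong₂ _+_ (coeff-pmulLin α β p j) (coeff-pmulLin α β r j))) ⟩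
  coeff (padd (pmulLin α β p) (pmulLin α β r)) j ∎
  where
  open ≡-Reasoning
  distrib : ∀ α β x′ y′ x y → α * (x′ + y′) + β * (x + y) ≡ (α * x′ + β * x) + (α * y′ + β * y)
  distrib = solve 6 (λ α β x′ y′ x y →
      (α :* (x′ :+ y′) :+ β :* (x :+ y))
    ⊜ (α :* x′ :+ β :* x :+ (α :* y′ :+ β :* y))) refl

pmulLin-pscale : ∀ α β c p → pmulLin α β (pscale c p) ≈ pscale c (pmulLin α β p)
pmulLin-pscale α β c p = coeffwise λ j → begin
  coeff (pmulLin α β (pscale c p)) j
    ≡⟨ coeff-pmulLin α β (pscale c p) j ⟩
  α * coeff (0ℚ ∷ pscale c p) j + β * coeff (pscale c p) j
    ≡⟨ cong₂ (λ u v → α * u + β * v) (coeff-shift-pscale c p j) (coeff-pscale c p j) ⟩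
  α * (c * coeff (0ℚ ∷ p) j) + β * (c * coeff p j)
    ≡⟨ distrib α β c (coeff (0ℚ ∷ p) j) (coeff p j) ⟩
  c * (α * coeff (0ℚ ∷ p) j + β * coeff p j)
    ≡⟨ sym (trans (coeff-pscale c (pmulLin α β p) j) (cong (c *_) (coeff-pmulLin α β p j))) ⟩
  coeff (pscale c (pmulLin α β p)) j ∎
  where
  open ≡-Reasoning
  distrib : ∀ α β c x′ x → α * (c * x′) + β * (c * x) ≡ c * (α * x′ + β * x)
  distrib = solve 5 (λ α β c x′ x →
      (α :* (c :* x′) :+ β :* (c :* x))
    ⊜ (c :* (α :* x′ :+ β :* x))) refl

pscale-padd : ∀ c p r → pscale c (padd p r) ≈ padd (pscale c p) (pscale c r)
pscale-padd c p r = coeffwise λ j → begin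
  coeff (pscale c (padd p r)) j          ≡⟨ trans (coeff-pscale c (padd p r) j) (cong (c *_) (coeff-padd p r j)) ⟩
  c * (coeff p j + coeff r j)            ≡⟨ ℚP.*-distribˡ-+ c (coeff p j) (coeff r j) ⟩
  c * coeff p j + c * coeff r j          ≡⟨ sym (trans (coeff-padd (pscale c p) (pscale c r) j)
                                                       (cong₂ _+_ (coeff-pscale c p j) (coeff-pscale c r j))) ⟩
  coeff (padd (pscale c p) (pscale c r)) j ∎
  where open ≡-Reasoning

padd-assoc : ∀ a b c → padd a (padd b c) ≈ padd (padd a b) c
padd-assoc a b c = coeffwise λ j → begin
  coeff (padd a (padd b c)) j           ≡⟨ trans (coeff-padd a (padd b c) j) (cong (_+_ (coeff a j)) (coeff-padd b c j)) ⟩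
  coeff a j + (coeff b j + coeff c j)   ≡⟨ ℚP.+-assoc (coeff a j) (coeff b j) (coeff c j) ⟨
  (coeff a j + coeff b j) + coeff c j   ≡⟨ sym (trans (coeff-padd (padd a b) c j) (cong (_+ coeff c j) (coeff-padd a b j))) ⟩
  coeff (padd (padd a b) c) j ∎
  where open ≡-Reasoning

pmulLin-factor : ∀ α β γ p → pmulLin α β p ≈ padd (pscale α (pmulLin 1ℚ γ p)) (pscale (β - α * γ) p)
pmulLin-factor α β γ p = coeffwise λ j → begin
  coeff (pmulLin α β p) j
    ≡⟨ coeff-pmulLin α β p j ⟩
  α * coeff (0ℚ ∷ p) j + β * coeff p j
    ≡⟨ identity α β γ (coeff (0ℚ ∷ p) j) (coeff p j) ⟩
  α * (1ℚ * coeff (0ℚ ∷ p) j + γ * coeff p j) + (β - α * γ) * coeff p j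
    ≡⟨ sym (trans (coeff-padd (pscale α (pmulLin 1ℚ γ p)) (pscale (β - α * γ) p) j)
                  (cong₂ _+_ (trans (coeff-pscale α (pmulLin 1ℚ γ p) j) (cong (α *_) (coeff-pmulLin 1ℚ γ p j)))
                             (coeff-pscale (β - α * γ) p j))) ⟩
  coeff (padd (pscale α (pmulLin 1ℚ γ p)) (pscale (β - α * γ) p)) j ∎
  where
  open ≡-Reasoning
  identity : ∀ α β γ x′ x → α * x′ + β * x ≡ α * (1ℚ * x′ + γ * x) + (β - α * γ) * x
  identity = solve 5 (λ α β γ x′ x →
      (α :* x′ :+ β :* x)
    ⊜ (α :* (Κ 1ℚ :* x′ :+ γ :* x) :+ (β :+ ⊝ (α :* γ)) :* x)) refl

pmulLin-+ : ∀ c d p → padd (pmulLin 1ℚ c p) (pscale d p) ≈ pmulLin 1ℚ (c + d) p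
pmulLin-+ c d p = coeffwise λ j → begin
  coeff (padd (pmulLin 1ℚ c p) (pscale d p)) j
    ≡⟨ trans (coeff-padd (pmulLin 1ℚ c p) (pscale d p) j) (cong₂ _+_ (coeff-pmulLin 1ℚ c p j) (coeff-pscale d p j)) ⟩
  (1ℚ * coeff (0ℚ ∷ p) j + c * coeff p j) + d * coeff p j
    ≡⟨ identity c d (coeff (0ℚ ∷ p) j) (coeff p j) ⟩
  1ℚ * coeff (0ℚ ∷ p) j + (c + d) * coeff p j
    ≡⟨ coeff-pmulLin 1ℚ (c + d) p j ⟨
  coeff (pmulLin 1ℚ (c + d) p) j ∎
  where
  open ≡-Reasoning
  identity : ∀ c d x′ x → (1ℚ * x′ + c * x) + d * x ≡ 1ℚ * x′ + (c + d) * x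
  identity = solve 4 (λ c d x′ x →
      (Κ 1ℚ :* x′ :+ c :* x :+ d :* x)
    ⊜ (Κ 1ℚ :* x′ :+ (c :+ d) :* x)) refl

pmulLin-node : ∀ {c d} → c ≡ d → ∀ p → pmulLin 1ℚ c p ≈ pmulLin 1ℚ d p
pmulLin-node refl p = ≈-refl

-- Newton and rising-factorial expansions

-- The Newton expansion ∑ₜ Lₜ (x + c₀) ⋯ (x + cₜ₋₁) of the list L with nodes c.
newton : (ℕ → ℚ) → Poly → Poly
newton c []       = []
newton c (h ∷ hs) = padd (h ∷ []) (pmulLin 1ℚ (c 0) (newton (c ∘ suc) hs))

newton-nodes : ∀ {c d} → (∀ i → c i ≡ d i) → ∀ L → newton c L ≡ newton d L
newton-nodes c≗d []       = refl
newton-nodes c≗d (h ∷ hs) =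
  cong₂ (λ c₀ N → padd (h ∷ []) (pmulLin 1ℚ c₀ N)) (c≗d 0) (newton-nodes (c≗d ∘ suc) hs)

newton-single : ∀ c h → newton c (h ∷ []) ≈ h ∷ []
newton-single c h = coeffwise λ { zero → ℚP.+-identityʳ h ; (suc j) → refl }

newton-≈[] : ∀ c {L} → L ≈ [] → newton c L ≈ []
newton-≈[] c {[]}     L≈[] = ≈-refl
newton-≈[] c {h ∷ hs} L≈[] = begin
  padd (h ∷ []) (pmulLin 1ℚ (c 0) (newton (c ∘ suc) hs))
    ≈⟨ padd-cong (≡⇒≈ (cong (_∷ []) (coeff-≡ L≈[] 0)))
                 (pmulLin-cong 1ℚ (c 0) (newton-≈[] (c ∘ suc) (≈[]-tail L≈[]))) ⟩
  padd (0ℚ ∷ []) (pmulLin 1ℚ (c 0) [])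
    ≈⟨ coeffwise (λ { zero → refl ; (suc j) → refl }) ⟩
  [] ∎
  where open ≈-Reasoning

newton-cong : ∀ c {L M} → L ≈ M → newton c L ≈ newton c M
newton-cong c {[]}     {[]}     L≈M = ≈-refl
newton-cong c {[]}     {m ∷ ms} L≈M = ≈-sym (newton-≈[] c (≈-sym L≈M))
newton-cong c {l ∷ ls} {[]}     L≈M = newton-≈[] c L≈M
newton-cong c {l ∷ ls} {m ∷ ms} L≈M =
  padd-cong (≡⇒≈ (cong (_∷ []) (coeff-≡ L≈M 0)))
            (pmulLin-cong 1ℚ (c 0) (newton-cong (c ∘ suc) (≈-tail L≈M)))

newton-padd : ∀ c L M → newton c (padd L M) ≈ padd (newton c L) (newton c M)
newton-padd c []       M        = ≈-refl
newton-padd c (l ∷ ls) []       = ≈-sym (padd-identityʳ (newton c (l ∷ ls)))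
newton-padd c (l ∷ ls) (m ∷ ms) = begin
  padd ((l + m) ∷ []) (pmulLin 1ℚ (c 0) (newton (c ∘ suc) (padd ls ms)))
    ≈⟨ padd-congʳ ((l + m) ∷ []) (pmulLin-cong 1ℚ (c 0) (newton-padd (c ∘ suc) ls ms)) ⟩
  padd (padd (l ∷ []) (m ∷ [])) (pmulLin 1ℚ (c 0) (padd (newton (c ∘ suc) ls) (newton (c ∘ suc) ms)))
    ≈⟨ padd-congʳ (padd (l ∷ []) (m ∷ [])) (pmulLin-padd 1ℚ (c 0) (newton (c ∘ suc) ls) (newton (c ∘ suc) ms)) ⟩
  padd (padd (l ∷ []) (m ∷ [])) (padd (pmulLin 1ℚ (c 0) (newton (c ∘ suc) ls)) (pmulLin 1ℚ (c 0) (newton (c ∘ suc) ms)))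
    ≈⟨ padd-interchange (l ∷ []) (m ∷ []) (pmulLin 1ℚ (c 0) (newton (c ∘ suc) ls)) (pmulLin 1ℚ (c 0) (newton (c ∘ suc) ms)) ⟩
  padd (newton c (l ∷ ls)) (newton c (m ∷ ms)) ∎
  where open ≈-Reasoning

newton-pscale : ∀ c d L → newton c (pscale d L) ≈ pscale d (newton c L)
newton-pscale c d []       = ≈-refl
newton-pscale c d (h ∷ hs) = begin
  padd ((d * h) ∷ []) (pmulLin 1ℚ (c 0) (newton (c ∘ suc) (pscale d hs)))
    ≈⟨ padd-congʳ ((d * h) ∷ []) (pmulLin-cong 1ℚ (c 0) (newton-pscale (c ∘ suc) d hs)) ⟩
  padd (pscale d (h ∷ [])) (pmulLin 1ℚ (c 0) (pscale d (newton (c ∘ suc) hs)))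
    ≈⟨ padd-congʳ (pscale d (h ∷ [])) (pmulLin-pscale 1ℚ (c 0) d (newton (c ∘ suc) hs)) ⟩
  padd (pscale d (h ∷ [])) (pscale d (pmulLin 1ℚ (c 0) (newton (c ∘ suc) hs)))
    ≈⟨ pscale-padd d (h ∷ []) (pmulLin 1ℚ (c 0) (newton (c ∘ suc) hs)) ⟨
  pscale d (newton c (h ∷ hs)) ∎
  where open ≈-Reasoning

pshift1≡newton : ∀ p → pshift1 p ≡ newton (λ _ → 1ℚ) p
pshift1≡newton []      = refl
pshift1≡newton (a ∷ p) = cong (λ N → padd (a ∷ []) (pmulLin 1ℚ 1ℚ N)) (pshift1≡newton p)

pshift1-cong : ∀ {p r} → p ≈ r → pshift1 p ≈ pshift1 r
pshift1-cong {p} {r} p≈r = begin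
  pshift1 p              ≡⟨ pshift1≡newton p ⟩
  newton (λ _ → 1ℚ) p    ≈⟨ newton-cong (λ _ → 1ℚ) p≈r ⟩
  newton (λ _ → 1ℚ) r    ≡⟨ pshift1≡newton r ⟨
  pshift1 r ∎
  where open ≈-Reasoning

pshift1-pmulLin : ∀ c p → pshift1 (pmulLin 1ℚ c p) ≈ pmulLin 1ℚ (1ℚ + c) (pshift1 p)
pshift1-pmulLin c p = begin
  pshift1 (pmulLin 1ℚ c p)
    ≡⟨ pshift1≡newton (pmulLin 1ℚ c p) ⟩
  newton one (padd (pscale 1ℚ (0ℚ ∷ p)) (pscale c p))
    ≈⟨ newton-padd one (pscale 1ℚ (0ℚ ∷ p)) (pscale c p) ⟩
  padd (newton one (pscale 1ℚ (0ℚ ∷ p))) (newton one (pscale c p))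
    ≈⟨ padd-cong (newton-pscale one 1ℚ (0ℚ ∷ p)) (newton-pscale one c p) ⟩
  padd (pscale 1ℚ (padd (0ℚ ∷ []) (pmulLin 1ℚ 1ℚ S))) (pscale c S)
    ≈⟨ padd-cong (pscale-cong 1ℚ (padd-zeroˡ (pmulLin 1ℚ 1ℚ S))) (≈-refl {pscale c S}) ⟩
  padd (pscale 1ℚ (pmulLin 1ℚ 1ℚ S)) (pscale c S)
    ≈⟨ padd-cong (pscale-identityˡ (pmulLin 1ℚ 1ℚ S)) (≈-refl {pscale c S}) ⟩
  padd (pmulLin 1ℚ 1ℚ S) (pscale c S)
    ≈⟨ pmulLin-+ 1ℚ c S ⟩
  pmulLin 1ℚ (1ℚ + c) S
    ≡⟨ cong (pmulLin 1ℚ (1ℚ + c)) (pshift1≡newton p) ⟨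
  pmulLin 1ℚ (1ℚ + c) (pshift1 p) ∎
  where
  open ≈-Reasoning
  one = λ (_ : ℕ) → 1ℚ
  S = newton one p

pshift1-newton : ∀ c L → pshift1 (newton c L) ≈ newton (λ i → 1ℚ + c i) L
pshift1-newton c []       = ≈-refl
pshift1-newton c (h ∷ hs) = begin
  pshift1 (newton c (h ∷ hs))
    ≡⟨ pshift1≡newton (newton c (h ∷ hs)) ⟩
  newton one (padd (h ∷ []) (pmulLin 1ℚ (c 0) N))
    ≈⟨ newton-padd one (h ∷ []) (pmulLin 1ℚ (c 0) N) ⟩
  padd (newton one (h ∷ [])) (newton one (pmulLin 1ℚ (c 0) N))
    ≈⟨ padd-cong (newton-single one h) (≡⇒≈ (sym (pshift1≡newton (pmulLin 1ℚ (c 0) N)))) ⟩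
  padd (h ∷ []) (pshift1 (pmulLin 1ℚ (c 0) N))
    ≈⟨ padd-congʳ (h ∷ []) (pshift1-pmulLin (c 0) N) ⟩
  padd (h ∷ []) (pmulLin 1ℚ (1ℚ + c 0) (pshift1 N))
    ≈⟨ padd-congʳ (h ∷ []) (pmulLin-cong 1ℚ (1ℚ + c 0) (pshift1-newton (c ∘ suc) hs)) ⟩
  newton (λ i → 1ℚ + c i) (h ∷ hs) ∎
  where
  open ≈-Reasoning
  one = λ (_ : ℕ) → 1ℚ
  N = newton (c ∘ suc) hs

-- rising a L = ∑ₜ Lₜ (x + a)(x + a + 1) ⋯ (x + a + t - 1)
rising : ℕ → Poly → Poly
rising a []       = []
rising a (h ∷ hs) = padd (h ∷ []) (pmulLin 1ℚ (q a) (rising (suc a) hs))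

rising≡newton : ∀ a L → rising a L ≡ newton (λ i → q (i ℕ.+ a)) L
rising≡newton a []       = refl
rising≡newton a (h ∷ hs) = cong (λ N → padd (h ∷ []) (pmulLin 1ℚ (q a) N))
  (trans (rising≡newton (suc a) hs) (newton-nodes (λ i → cong q (ℕP.+-suc i a)) hs))

rising-cong : ∀ a {L M} → L ≈ M → rising a L ≈ rising a M
rising-cong a {L} {M} L≈M = begin
  rising a L                      ≡⟨ rising≡newton a L ⟩
  newton (λ i → q (i ℕ.+ a)) L    ≈⟨ newton-cong (λ i → q (i ℕ.+ a)) L≈M ⟩
  newton (λ i → q (i ℕ.+ a)) M    ≡⟨ rising≡newton a M ⟨
  rising a M ∎
  where open ≈-Reasoning

rising-padd : ∀ a L M → rising a (padd L M) ≈ padd (rising a L) (rising a M)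
rising-padd a L M = begin
  rising a (padd L M)
    ≡⟨ rising≡newton a (padd L M) ⟩
  newton (λ i → q (i ℕ.+ a)) (padd L M)
    ≈⟨ newton-padd (λ i → q (i ℕ.+ a)) L M ⟩
  padd (newton (λ i → q (i ℕ.+ a)) L) (newton (λ i → q (i ℕ.+ a)) M)
    ≡⟨ cong₂ padd (rising≡newton a L) (rising≡newton a M) ⟨
  padd (rising a L) (rising a M) ∎
  where open ≈-Reasoning

rising-pscale : ∀ a c L → rising a (pscale c L) ≈ pscale c (rising a L)
rising-pscale a c L = begin
  rising a (pscale c L)                        ≡⟨ rising≡newton a (pscale c L) ⟩
  newton (λ i → q (i ℕ.+ a)) (pscale c L)      ≈⟨ newton-pscale (λ i → q (i ℕ.+ a)) c L ⟩
  pscale c (newton (λ i → q (i ℕ.+ a)) L)      ≡⟨ cong (pscale c) (rising≡newton a L) ⟨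
  pscale c (rising a L) ∎
  where open ≈-Reasoning

pshift1-rising : ∀ a L → pshift1 (rising a L) ≈ rising (suc a) L
pshift1-rising a L = begin
  pshift1 (rising a L)                       ≡⟨ cong pshift1 (rising≡newton a L) ⟩
  pshift1 (newton (λ i → q (i ℕ.+ a)) L)     ≈⟨ pshift1-newton (λ i → q (i ℕ.+ a)) L ⟩
  newton (λ i → 1ℚ + q (i ℕ.+ a)) L          ≡⟨ newton-nodes (λ i → sym (trans (cong q (ℕP.+-suc i a)) (q-suc (i ℕ.+ a)))) L ⟩
  newton (λ i → q (i ℕ.+ suc a)) L           ≡⟨ rising≡newton (suc a) L ⟨
  rising (suc a) L ∎
  where open ≈-Reasoning

rising-single : ∀ a h → rising a (h ∷ []) ≈ h ∷ []
rising-single a h = coeffwise λ { zero → ℚP.+-identityʳ h ; (suc j) → refl }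

unit : ℕ → Poly
unit zero    = 1ℚ ∷ []
unit (suc k) = 0ℚ ∷ unit k

rising-unit : ∀ a k → rising a (unit k) ≈ prodFrom a k
rising-unit a zero    = rising-single a 1ℚ
rising-unit a (suc k) = ≈-trans (padd-zeroˡ (pmulLin 1ℚ (q a) (rising (suc a) (unit k))))
                                (pmulLin-cong 1ℚ (q a) (rising-unit (suc a) k))

-- Coefficients of a rising-factorial expansion rewritten with base point one higher:
-- (x + a) ⋯ (x + a + t - 1) = (x + a + 1) ⋯ (x + a + t) - t (x + a + 1) ⋯ (x + a + t - 1).
rebase : Poly → Poly
rebase []       = []
rebase (h ∷ hs) = padd (h ∷ rebase hs) (pscale (- 1ℚ) hs)

coeff-rebase : ∀ L t → coeff (rebase L) t ≡ coeff L t - q (suc t) * coeff L (suc t)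
coeff-rebase []       t       = zero-minus (q (suc t))
  where
  zero-minus : ∀ x → 0ℚ ≡ 0ℚ - x * 0ℚ
  zero-minus = solve 1 (λ x → (Κ 0ℚ) ⊜ (Κ 0ℚ :+ ⊝ (x :* Κ 0ℚ))) refl
coeff-rebase (h ∷ hs) zero    = begin
  coeff (padd (h ∷ rebase hs) (pscale (- 1ℚ) hs)) 0  ≡⟨ coeff-padd (h ∷ rebase hs) (pscale (- 1ℚ) hs) 0 ⟩
  h + coeff (pscale (- 1ℚ) hs) 0                    ≡⟨ cong (_+_ h) (coeff-pscale (- 1ℚ) hs 0) ⟩
  h + (- 1ℚ) * coeff hs 0                           ≡⟨ identity h (coeff hs 0) ⟩
  h - q 1 * coeff hs 0 ∎
  where
  open ≡-Reasoning
  identity : ∀ h x → h + (- 1ℚ) * x ≡ h - q 1 * x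
  identity = solve 2 (λ h x → (h :+ ⊝ Κ 1ℚ :* x) ⊜ (h :+ ⊝ (Κ (q 1) :* x))) refl
coeff-rebase (h ∷ hs) (suc t) = begin
  coeff (padd (h ∷ rebase hs) (pscale (- 1ℚ) hs)) (suc t)
    ≡⟨ coeff-padd (h ∷ rebase hs) (pscale (- 1ℚ) hs) (suc t) ⟩
  coeff (rebase hs) t + coeff (pscale (- 1ℚ) hs) (suc t)
    ≡⟨ cong₂ _+_ (coeff-rebase hs t) (coeff-pscale (- 1ℚ) hs (suc t)) ⟩
  (coeff hs t - q (suc t) * coeff hs (suc t)) + (- 1ℚ) * coeff hs (suc t)
    ≡⟨ identity (coeff hs t) (q (suc t)) (coeff hs (suc t)) ⟩
  coeff hs t - (1ℚ + q (suc t)) * coeff hs (suc t)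
    ≡⟨ cong (λ w → coeff hs t - w * coeff hs (suc t)) (q-suc (suc t)) ⟨
  coeff hs t - q (suc (suc t)) * coeff hs (suc t) ∎
  where
  open ≡-Reasoning
  identity : ∀ x w y → (x - w * y) + (- 1ℚ) * y ≡ x - (1ℚ + w) * y
  identity = solve 3 (λ x w y → (x :+ ⊝ (w :* y) :+ ⊝ Κ 1ℚ :* y) ⊜ (x :+ ⊝ ((Κ 1ℚ :+ w) :* y))) refl

coeff-shift-rebase : ∀ L t → coeff (0ℚ ∷ rebase L) t ≡ coeff (0ℚ ∷ L) t - q t * coeff L t
coeff-shift-rebase L zero    = zero-minus (coeff L 0)
  where
  zero-minus : ∀ x → 0ℚ ≡ 0ℚ - q 0 * x
  zero-minus = solve 1 (λ x → (Κ 0ℚ) ⊜ (Κ 0ℚ :+ ⊝ (Κ (q 0) :* x))) refl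
coeff-shift-rebase L (suc t) = coeff-rebase L t

rising-rebase : ∀ a L → rising a L ≈ rising (suc a) (rebase L)
rising-rebase a []       = ≈-refl
rising-rebase a (h ∷ hs) = begin
  padd (h ∷ []) (pmulLin 1ℚ (q a) R)
    ≈⟨ padd-congʳ (h ∷ []) (pmulLin-node (sym a+1-1) R) ⟩
  padd (h ∷ []) (pmulLin 1ℚ (q (suc a) + - 1ℚ) R)
    ≈⟨ padd-congʳ (h ∷ []) (pmulLin-+ (q (suc a)) (- 1ℚ) R) ⟨
  padd (h ∷ []) (padd (pmulLin 1ℚ (q (suc a)) R) (pscale (- 1ℚ) R))
    ≈⟨ padd-congʳ (h ∷ []) (padd-cong (pmulLin-cong 1ℚ (q (suc a)) (rising-rebase (suc a) hs))
                                      (≈-sym (rising-pscale (suc a) (- 1ℚ) hs))) ⟩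
  padd (h ∷ []) (padd (pmulLin 1ℚ (q (suc a)) (rising (suc (suc a)) (rebase hs))) (rising (suc a) (pscale (- 1ℚ) hs)))
    ≈⟨ padd-assoc (h ∷ []) (pmulLin 1ℚ (q (suc a)) (rising (suc (suc a)) (rebase hs))) (rising (suc a) (pscale (- 1ℚ) hs)) ⟩
  padd (rising (suc a) (h ∷ rebase hs)) (rising (suc a) (pscale (- 1ℚ) hs))
    ≈⟨ rising-padd (suc a) (h ∷ rebase hs) (pscale (- 1ℚ) hs) ⟨
  rising (suc a) (rebase (h ∷ hs)) ∎
  where
  open ≈-Reasoning
  R = rising (suc a) hs
  a+1-1 : q (suc a) + - 1ℚ ≡ q a
  a+1-1 = trans (cong (_+ - 1ℚ) (q-suc a)) (cancel (q a))
    where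
    cancel : ∀ x → (1ℚ + x) + - 1ℚ ≡ x
    cancel = solve 1 (λ x → (Κ 1ℚ :+ x :+ ⊝ Κ 1ℚ) ⊜ (x)) refl

mulLinBasis : ℕ → ℚ → ℚ → Poly → Poly
mulLinBasis a α β L = padd (pscale α (0ℚ ∷ rebase L)) (pscale (β - α * q a) L)

rising-pmulLin : ∀ a α β L → pmulLin α β (rising a L) ≈ rising a (mulLinBasis a α β L)
rising-pmulLin a α β L = begin
  pmulLin α β (rising a L)
    ≈⟨ pmulLin-factor α β (q a) (rising a L) ⟩
  padd (pscale α (pmulLin 1ℚ (q a) (rising a L))) (pscale (β - α * q a) (rising a L))
    ≈⟨ padd-cong (pscale-cong α (pmulLin-cong 1ℚ (q a) (rising-rebase a L))) (≈-refl {pscale (β - α * q a) (rising a L)}) ⟩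
  padd (pscale α (pmulLin 1ℚ (q a) (rising (suc a) (rebase L)))) (pscale (β - α * q a) (rising a L))
    ≈⟨ padd-cong (pscale-cong α (padd-zeroˡ (pmulLin 1ℚ (q a) (rising (suc a) (rebase L))))) (≈-refl {pscale (β - α * q a) (rising a L)}) ⟨
  padd (pscale α (rising a (0ℚ ∷ rebase L))) (pscale (β - α * q a) (rising a L))
    ≈⟨ padd-cong (rising-pscale a α (0ℚ ∷ rebase L)) (rising-pscale a (β - α * q a) L) ⟨
  padd (rising a (pscale α (0ℚ ∷ rebase L))) (rising a (pscale (β - α * q a) L))
    ≈⟨ rising-padd a (pscale α (0ℚ ∷ rebase L)) (pscale (β - α * q a) L) ⟨
  rising a (mulLinBasis a α β L) ∎
  where open ≈-Reasoning

coeff-mulLinBasis : ∀ a α β L t →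
  coeff (mulLinBasis a α β L) t ≡ α * (coeff (0ℚ ∷ L) t - q (a ℕ.+ t) * coeff L t) + β * coeff L t
coeff-mulLinBasis a α β L t = begin
  coeff (mulLinBasis a α β L) t
    ≡⟨ coeff-padd (pscale α (0ℚ ∷ rebase L)) (pscale (β - α * q a) L) t ⟩
  coeff (pscale α (0ℚ ∷ rebase L)) t + coeff (pscale (β - α * q a) L) t
    ≡⟨ cong₂ _+_ (trans (coeff-pscale α (0ℚ ∷ rebase L) t) (cong (α *_) (coeff-shift-rebase L t)))
                 (coeff-pscale (β - α * q a) L t) ⟩
  α * (coeff (0ℚ ∷ L) t - q t * coeff L t) + (β - α * q a) * coeff L t
    ≡⟨ identity α β (q a) (q t) (coeff (0ℚ ∷ L) t) (coeff L t) ⟩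
  α * (coeff (0ℚ ∷ L) t - (q a + q t) * coeff L t) + β * coeff L t
    ≡⟨ cong (λ w → α * (coeff (0ℚ ∷ L) t - w * coeff L t) + β * coeff L t) (q-+ a t) ⟨
  α * (coeff (0ℚ ∷ L) t - q (a ℕ.+ t) * coeff L t) + β * coeff L t ∎
  where
  open ≡-Reasoning
  identity : ∀ α β a t x′ x → α * (x′ - t * x) + (β - α * a) * x ≡ α * (x′ - (a + t) * x) + β * x
  identity = solve 6 (λ α β a t x′ x →
      (α :* (x′ :+ ⊝ (t :* x)) :+ (β :+ ⊝ (α :* a)) :* x)
    ⊜ (α :* (x′ :+ ⊝ ((a :+ t) :* x)) :+ β :* x)) refl

-- Exact division by x + c

coeff-cons : ∀ h p j → coeff (h ∷ p) j ≡ coeff (h ∷ []) j + coeff (0ℚ ∷ p) j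
coeff-cons h p zero    = sym (ℚP.+-identityʳ h)
coeff-cons h p (suc j) = sym (ℚP.+-identityˡ (coeff p j))

coeff-beyond : ∀ p {j} → length p ≤ j → coeff p j ≡ 0ℚ
coeff-beyond []      _         = refl
coeff-beyond (a ∷ p) (s≤s len≤j) = coeff-beyond p len≤j

pdivLin′-spec : ∀ c p → p ≈ padd (pmulLin 1ℚ c (proj₁ (pdivLin' c p))) (proj₂ (pdivLin' c p) ∷ [])
pdivLin′-spec c []      = coeffwise λ { zero → refl ; (suc j) → refl }
pdivLin′-spec c (a ∷ p) with pdivLin' c p | pdivLin′-spec c p
... | (qt , r) | ih = coeffwise go
  where
  open ≡-Reasoning
  identity₀ : ∀ a c r → a ≡ (1ℚ * 0ℚ + c * r) + (a - c * r)
  identity₀ = solve 3 (λ a c r → (a) ⊜ (Κ 1ℚ :* Κ 0ℚ :+ c :* r :+ (a :+ ⊝ (c :* r)))) refl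
  identity₁ : ∀ c x′ x ρ → (1ℚ * x′ + c * x) + ρ ≡ (1ℚ * (ρ + x′) + c * x) + 0ℚ
  identity₁ = solve 4 (λ c x′ x ρ →
      (Κ 1ℚ :* x′ :+ c :* x :+ ρ)
    ⊜ (Κ 1ℚ :* (ρ :+ x′) :+ c :* x :+ Κ 0ℚ)) refl
  go : ∀ j → coeff (a ∷ p) j ≡ coeff (padd (pmulLin 1ℚ c (r ∷ qt)) ((a - c * r) ∷ [])) j
  go zero = begin
    a                                  ≡⟨ identity₀ a c r ⟩
    (1ℚ * 0ℚ + c * r) + (a - c * r)    ≡⟨ cong (_+ (a - c * r)) (coeff-pmulLin 1ℚ c (r ∷ qt) 0) ⟨
    coeff (pmulLin 1ℚ c (r ∷ qt)) 0 + (a - c * r)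
      ≡⟨ coeff-padd (pmulLin 1ℚ c (r ∷ qt)) ((a - c * r) ∷ []) 0 ⟨
    coeff (padd (pmulLin 1ℚ c (r ∷ qt)) ((a - c * r) ∷ [])) 0 ∎
  go (suc j) = begin
    coeff p j
      ≡⟨ coeff-≡ ih j ⟩
    coeff (padd (pmulLin 1ℚ c qt) (r ∷ [])) j
      ≡⟨ trans (coeff-padd (pmulLin 1ℚ c qt) (r ∷ []) j) (cong (_+ coeff (r ∷ []) j) (coeff-pmulLin 1ℚ c qt j)) ⟩
    (1ℚ * coeff (0ℚ ∷ qt) j + c * coeff qt j) + coeff (r ∷ []) j
      ≡⟨ identity₁ c (coeff (0ℚ ∷ qt) j) (coeff qt j) (coeff (r ∷ []) j) ⟩
    (1ℚ * (coeff (r ∷ []) j + coeff (0ℚ ∷ qt) j) + c * coeff qt j) + 0ℚ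
      ≡⟨ cong (λ w → (1ℚ * w + c * coeff qt j) + 0ℚ) (coeff-cons r qt j) ⟨
    (1ℚ * coeff (r ∷ qt) j + c * coeff qt j) + 0ℚ
      ≡⟨ sym (trans (coeff-padd (pmulLin 1ℚ c (r ∷ qt)) ((a - c * r) ∷ []) (suc j))
                    (cong (_+ 0ℚ) (coeff-pmulLin 1ℚ c (r ∷ qt) (suc j)))) ⟩
    coeff (padd (pmulLin 1ℚ c (r ∷ qt)) ((a - c * r) ∷ [])) (suc j) ∎

pmulLin-injective : ∀ c {A B r} → pmulLin 1ℚ c A ≈ padd (pmulLin 1ℚ c B) (r ∷ []) → A ≈ B
pmulLin-injective c {A} {B} {r} cA≈cB+r = coeffwise λ j → downward n j (ℕP.m≤m+n n j)
  where
  n = length A ⊔ length B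
  coeff-step : ∀ j → 1ℚ * coeff A j + c * coeff A (suc j) ≡ (1ℚ * coeff B j + c * coeff B (suc j)) + 0ℚ
  coeff-step j = begin
    1ℚ * coeff A j + c * coeff A (suc j)               ≡⟨ coeff-pmulLin 1ℚ c A (suc j) ⟨
    coeff (pmulLin 1ℚ c A) (suc j)                      ≡⟨ coeff-≡ cA≈cB+r (suc j) ⟩
    coeff (padd (pmulLin 1ℚ c B) (r ∷ [])) (suc j)      ≡⟨ coeff-padd (pmulLin 1ℚ c B) (r ∷ []) (suc j) ⟩
    coeff (pmulLin 1ℚ c B) (suc j) + 0ℚ                 ≡⟨ cong (_+ 0ℚ) (coeff-pmulLin 1ℚ c B (suc j)) ⟩
    (1ℚ * coeff B j + c * coeff B (suc j)) + 0ℚ ∎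
    where open ≡-Reasoning
  downward : ∀ i j → n ≤ i ℕ.+ j → coeff A j ≡ coeff B j
  downward zero    j n≤j = trans (coeff-beyond A (ℕP.≤-trans (ℕP.m≤m⊔n (length A) (length B)) n≤j))
                                 (sym (coeff-beyond B (ℕP.≤-trans (ℕP.m≤n⊔m (length A) (length B)) n≤j)))
  downward (suc i) j n≤i+j =
    cancel c (coeff A j) (coeff B j) (coeff A (suc j)) (coeff B (suc j))
           (coeff-step j) (downward i (suc j) (subst (n ≤_) (sym (ℕP.+-suc i j)) n≤i+j))
    where
    cancel : ∀ c x x′ y y′ → 1ℚ * x + c * y ≡ (1ℚ * x′ + c * y′) + 0ℚ → y ≡ y′ → x ≡ x′
    cancel c x x′ y y′ eq y≡y′ = combine (eq ⊕ - c ⊙ y≡y′) (identity c x x′ y y′)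
      where
      identity : ∀ c x x′ y y′ →
        x - x′ ≡ ((1ℚ * x + c * y) + (- c) * y) - (((1ℚ * x′ + c * y′) + 0ℚ) + (- c) * y′)
      identity = solve 5 (λ c x x′ y y′ →
          (x :+ ⊝ x′)
        ⊜ (Κ 1ℚ :* x :+ c :* y :+ ⊝ c :* y :+ ⊝ (Κ 1ℚ :* x′ :+ c :* y′ :+ Κ 0ℚ :+ ⊝ c :* y′))) refl

pdivLin-exact : ∀ c {N Q} → N ≈ pmulLin 1ℚ c Q → pdivLin c N ≈ Q
pdivLin-exact c {N} N≈cQ = ≈-sym (pmulLin-injective c (≈-trans (≈-sym N≈cQ) (pdivLin′-spec c N)))

-- Binomial coefficients and the closed forms

absorption : ∀ n k → suc k ℕ.* (suc n C suc k) ≡ suc n ℕ.* (n C k)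
absorption zero    zero    = refl
absorption zero    (suc k) = trans (cong (suc (suc k) ℕ.*_) (k>n⇒nCk≡0 {1} {suc (suc k)} (s≤s (s≤s z≤n)))) (ℕP.*-zeroʳ (suc (suc k)))
absorption (suc n) zero    = trans (ℕP.*-identityˡ (suc (suc n) C 1)) (trans (nC1≡n (suc (suc n))) (sym (ℕP.*-identityʳ (suc (suc n)))))
absorption (suc n) (suc k) = begin
  suc (suc k) ℕ.* (suc (suc n) C suc (suc k))
    ≡⟨ cong (suc (suc k) ℕ.*_) (nCk+nC[k+1]≡[n+1]C[k+1] (suc n) (suc k)) ⟨
  suc (suc k) ℕ.* (suc n C suc k ℕ.+ suc n C suc (suc k))
    ≡⟨ regroup (suc k) (suc n C suc k) (suc n C suc (suc k)) ⟩
  suc k ℕ.* (suc n C suc k) ℕ.+ suc (suc k) ℕ.* (suc n C suc (suc k)) ℕ.+ suc n C suc k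
    ≡⟨ cong₂ (λ x y → x ℕ.+ y ℕ.+ suc n C suc k) (absorption n k) (absorption n (suc k)) ⟩
  suc n ℕ.* (n C k) ℕ.+ suc n ℕ.* (n C suc k) ℕ.+ suc n C suc k
    ≡⟨ cong (ℕ._+ suc n C suc k) (ℕP.*-distribˡ-+ (suc n) (n C k) (n C suc k)) ⟨
  suc n ℕ.* (n C k ℕ.+ n C suc k) ℕ.+ suc n C suc k
    ≡⟨ cong (λ x → suc n ℕ.* x ℕ.+ suc n C suc k) (nCk+nC[k+1]≡[n+1]C[k+1] n k) ⟩
  suc n ℕ.* (suc n C suc k) ℕ.+ suc n C suc k
    ≡⟨ ℕP.+-comm (suc n ℕ.* (suc n C suc k)) (suc n C suc k) ⟩
  suc (suc n) ℕ.* (suc n C suc k) ∎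
  where
  open ≡-Reasoning
  regroup : ∀ k x y → suc k ℕ.* (x ℕ.+ y) ≡ k ℕ.* x ℕ.+ suc k ℕ.* y ℕ.+ x
  regroup = ℕSolver.solve-∀

C-sym : ∀ a b → (a ℕ.+ b) C a ≡ (a ℕ.+ b) C b
C-sym a b = trans (nCk≡nC[n∸k] (ℕP.m≤m+n a b)) (cong ((a ℕ.+ b) C_) (ℕP.m+n∸m≡n a b))

absorptionʳ : ∀ a b → suc b ℕ.* ((a ℕ.+ suc b) C a) ≡ suc (a ℕ.+ b) ℕ.* ((a ℕ.+ b) C a)
absorptionʳ a b = begin
  suc b ℕ.* ((a ℕ.+ suc b) C a)          ≡⟨ cong (suc b ℕ.*_) (trans (C-sym a (suc b)) (cong (_C suc b) (ℕP.+-comm a (suc b)))) ⟩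
  suc b ℕ.* (suc (b ℕ.+ a) C suc b)      ≡⟨ absorption (b ℕ.+ a) b ⟩
  suc (b ℕ.+ a) ℕ.* ((b ℕ.+ a) C b)      ≡⟨ cong₂ (λ n m → suc n ℕ.* m) (ℕP.+-comm b a) (trans (C-sym b a) (cong (_C a) (ℕP.+-comm b a))) ⟩
  suc (a ℕ.+ b) ℕ.* ((a ℕ.+ b) C a) ∎
  where open ≡-Reasoning

q-absorption : ∀ n k → q (suc k) * q (suc n C suc k) ≡ q (suc n) * q (n C k)
q-absorption n k = trans (sym (q-* (suc k) (suc n C suc k))) (trans (cong q (absorption n k)) (q-* (suc n) (n C k)))

q-absorptionʳ : ∀ a b → q (suc b) * q ((a ℕ.+ suc b) C a) ≡ q (suc (a ℕ.+ b)) * q ((a ℕ.+ b) C a)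
q-absorptionʳ a b =
  trans (sym (q-* (suc b) ((a ℕ.+ suc b) C a))) (trans (cong q (absorptionʳ a b)) (q-* (suc (a ℕ.+ b)) ((a ℕ.+ b) C a)))

q-affine : ∀ {n} c t m u → n ≡ c ℕ.+ t ℕ.+ m ℕ.* u → q n ≡ q c + q t + q m * q u
q-affine c t m u refl = trans (q-+ (c ℕ.+ t) (m ℕ.* u)) (cong₂ _+_ (q-+ c t) (q-* m u))

private
  scale : ∀ c s n x y → s * x ≡ n * y → s * (c * x) ≡ n * (c * y)
  scale c s n x y eq = combine (c ⊙ eq) (identity c s n x y)
    where
    identity : ∀ c s n x y →
      (s * (c * x)) - (n * (c * y)) ≡ (c * (s * x)) - (c * (n * y))
    identity = solve 5 (λ c s n x y →
        (s :* (c :* x) :+ ⊝ (n :* (c :* y)))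
      ⊜ (c :* (s :* x) :+ ⊝ (c :* (n :* y)))) refl

opaque
  -- 4ᵘ u! binom(t + 2u + 1, t), the coefficient of x(x+1)⋯(x+t-1) in P_{2(t+u+1)}.
  coeffE : ℕ → ℕ → ℚ
  coeffE t u = q (4 ^ u) * q (u !) * q ((t ℕ.+ suc (2 ℕ.* u)) C t)

  coeffE-def : ∀ t u → coeffE t u ≡ q (4 ^ u) * q (u !) * q ((t ℕ.+ suc (2 ℕ.* u)) C t)
  coeffE-def t u = refl

coeffE-zero : ∀ t → coeffE t 0 ≡ 1ℚ + q t
coeffE-zero t = begin
  coeffE t 0                        ≡⟨ coeffE-def t 0 ⟩
  q 1 * q 1 * q ((t ℕ.+ 1) C t)     ≡⟨ cong (λ n → q 1 * q 1 * q n) (trans (C-sym t 1) (nC1≡n (t ℕ.+ 1))) ⟩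
  q 1 * q 1 * q (t ℕ.+ 1)           ≡⟨ cong (q 1 * q 1 *_) (trans (cong q (ℕP.+-comm t 1)) (q-suc t)) ⟩
  q 1 * q 1 * (1ℚ + q t)            ≡⟨ ℚP.*-identityˡ (1ℚ + q t) ⟩
  1ℚ + q t ∎
  where open ≡-Reasoning

coeffE-sucˡ : ∀ t u → (1ℚ + q t) * coeffE (suc t) u ≡ (q 2 + q t + q 2 * q u) * coeffE t u
coeffE-sucˡ t u = begin
  (1ℚ + q t) * coeffE (suc t) u
    ≡⟨ cong (_* coeffE (suc t) u) (q-suc t) ⟨
  q (suc t) * coeffE (suc t) u
    ≡⟨ cong (q (suc t) *_) (coeffE-def (suc t) u) ⟩
  q (suc t) * (q (4 ^ u) * q (u !) * q ((suc t ℕ.+ suc (2 ℕ.* u)) C suc t))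
    ≡⟨ scale (q (4 ^ u) * q (u !)) (q (suc t)) (q (suc (t ℕ.+ suc (2 ℕ.* u))))
             (q ((suc t ℕ.+ suc (2 ℕ.* u)) C suc t)) (q ((t ℕ.+ suc (2 ℕ.* u)) C t))
             (q-absorption (t ℕ.+ suc (2 ℕ.* u)) t) ⟩
  q (suc (t ℕ.+ suc (2 ℕ.* u))) * (q (4 ^ u) * q (u !) * q ((t ℕ.+ suc (2 ℕ.* u)) C t))
    ≡⟨ cong (q (suc (t ℕ.+ suc (2 ℕ.* u))) *_) (coeffE-def t u) ⟨
  q (suc (t ℕ.+ suc (2 ℕ.* u))) * coeffE t u
    ≡⟨ cong (_* coeffE t u) (q-affine 2 t 2 u (shape t u)) ⟩
  (q 2 + q t + q 2 * q u) * coeffE t u ∎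
  where
  open ≡-Reasoning
  shape : ∀ t u → suc (t ℕ.+ suc (2 ℕ.* u)) ≡ 2 ℕ.+ t ℕ.+ 2 ℕ.* u
  shape = ℕSolver.solve-∀

coeffE-sucʳ : ∀ t u → (q 3 + q 2 * q u) * coeffE t (suc u)
                       ≡ q 2 * (q 3 + q t + q 2 * q u) * (q 2 + q t + q 2 * q u) * coeffE t u
coeffE-sucʳ t u = begin
  (q 3 + q 2 * q u) * coeffE t (suc u)
    ≡⟨ cong ((q 3 + q 2 * q u) *_) unfold ⟩
  (q 3 + q 2 * q u) * (q 4 * A * ((1ℚ + q u) * B) * q C₃)
    ≡⟨ algebra (q t) (q u) A B (q C₁) (q C₂) (q C₃)
         (convert (q-absorptionʳ t (suc (suc v))) (q-affine 3 0 2 u (shape₃ u)) (q-affine 3 t 2 u (shape₃′ t u)))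
         (convert (q-absorptionʳ t (suc v)) (q-affine 2 0 2 u (shape₂ u)) (q-affine 2 t 2 u (shape₂′ t u))) ⟩
  q 2 * (q 3 + q t + q 2 * q u) * (q 2 + q t + q 2 * q u) * (A * B * q C₁)
    ≡⟨ cong (q 2 * (q 3 + q t + q 2 * q u) * (q 2 + q t + q 2 * q u) *_) (coeffE-def t u) ⟨
  q 2 * (q 3 + q t + q 2 * q u) * (q 2 + q t + q 2 * q u) * coeffE t u ∎
  where
  open ≡-Reasoning
  v = 2 ℕ.* u
  A = q (4 ^ u)
  B = q (u !)
  C₁ = (t ℕ.+ suc v) C t
  C₂ = (t ℕ.+ suc (suc v)) C t
  C₃ = (t ℕ.+ suc (suc (suc v))) C t
  unfold : coeffE t (suc u) ≡ q 4 * A * ((1ℚ + q u) * B) * q C₃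
  unfold = trans (coeffE-def t (suc u)) (cong₂ _*_ (cong₂ _*_ (q-* 4 (4 ^ u)) (trans (q-* (suc u) (u !)) (cong (_* B) (q-suc u))))
                     (cong (λ w → q ((t ℕ.+ suc w) C t)) (ℕP.*-suc 2 u)))
  convert : ∀ {m n x y m′ n′} → m * x ≡ n * y → m ≡ m′ → n ≡ n′ → m′ * x ≡ n′ * y
  convert eq refl refl = eq
  shape₃ : ∀ u → suc (suc (suc (2 ℕ.* u))) ≡ 3 ℕ.+ 0 ℕ.+ 2 ℕ.* u
  shape₃ = ℕSolver.solve-∀
  shape₃′ : ∀ t u → suc (t ℕ.+ suc (suc (2 ℕ.* u))) ≡ 3 ℕ.+ t ℕ.+ 2 ℕ.* u
  shape₃′ = ℕSolver.solve-∀
  shape₂ : ∀ u → suc (suc (2 ℕ.* u)) ≡ 2 ℕ.+ 0 ℕ.+ 2 ℕ.* u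
  shape₂ = ℕSolver.solve-∀
  shape₂′ : ∀ t u → suc (t ℕ.+ suc (2 ℕ.* u)) ≡ 2 ℕ.+ t ℕ.+ 2 ℕ.* u
  shape₂′ = ℕSolver.solve-∀
  algebra : ∀ T U A B C₁ C₂ C₃ →
    (q 3 + q 0 + q 2 * U) * C₃ ≡ (q 3 + T + q 2 * U) * C₂ →
    (q 2 + q 0 + q 2 * U) * C₂ ≡ (q 2 + T + q 2 * U) * C₁ →
    (q 3 + q 2 * U) * (q 4 * A * ((1ℚ + U) * B) * C₃) ≡ q 2 * (q 3 + T + q 2 * U) * (q 2 + T + q 2 * U) * (A * B * C₁)
  algebra T U A B C₁ C₂ C₃ h₃ h₂ =
    combine (q 4 * A * (1ℚ + U) * B ⊙ h₃ ⊕ q 2 * A * B * (q 3 + T + q 2 * U) ⊙ h₂) (identity T U A B C₁ C₂ C₃)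
    where
    identity : ∀ T U A B C₁ C₂ C₃ →
      ((q 3 + q 2 * U) * (q 4 * A * ((1ℚ + U) * B) * C₃))
        - (q 2 * (q 3 + T + q 2 * U) * (q 2 + T + q 2 * U) * (A * B * C₁))
        ≡ ((q 4 * A * (1ℚ + U) * B) * ((q 3 + q 0 + q 2 * U) * C₃) + (q 2 * A * B * (q 3 + T + q 2 * U)) * ((q 2 + q 0 + q 2 * U) * C₂))
          - ((q 4 * A * (1ℚ + U) * B) * ((q 3 + T + q 2 * U) * C₂) + (q 2 * A * B * (q 3 + T + q 2 * U)) * ((q 2 + T + q 2 * U) * C₁))
    identity = solve 7 (λ T U A B C₁ C₂ C₃ →
        ((Κ (q 3) :+ Κ (q 2) :* U) :* (Κ (q 4) :* A :* ((Κ 1ℚ :+ U) :* B) :* C₃)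
          :+ ⊝ (Κ (q 2) :* (Κ (q 3) :+ T :+ Κ (q 2) :* U) :* (Κ (q 2) :+ T :+ Κ (q 2) :* U) :* (A :* B :* C₁)))
      ⊜ (Κ (q 4) :* A :* (Κ 1ℚ :+ U) :* B :* ((Κ (q 3) :+ Κ (q 0) :+ Κ (q 2) :* U) :* C₃)
          :+ Κ (q 2) :* A :* B :* (Κ (q 3) :+ T :+ Κ (q 2) :* U) :* ((Κ (q 2) :+ Κ (q 0) :+ Κ (q 2) :* U) :* C₂)
          :+ ⊝ (Κ (q 4) :* A :* (Κ 1ℚ :+ U) :* B :* ((Κ (q 3) :+ T :+ Κ (q 2) :* U) :* C₂) :+ Κ (q 2) :* A :* B :* (Κ (q 3) :+ T :+ Κ (q 2) :* U) :* ((Κ (q 2) :+ T :+ Κ (q 2) :* U) :* C₁)))) refl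

antidiagonal : (ℕ → ℕ → ℚ) → ℕ → Poly
antidiagonal f zero    = []
antidiagonal f (suc n) = f 0 n ∷ antidiagonal (λ t → f (suc t)) n

coeff-antidiagonal : ∀ f t u {n} → n ≡ suc (t ℕ.+ u) → coeff (antidiagonal f n) t ≡ f t u
coeff-antidiagonal f zero    u refl = refl
coeff-antidiagonal f (suc t) u refl = coeff-antidiagonal (λ t → f (suc t)) t u refl

coeff-antidiagonal-≥ : ∀ f {n t} → n ≤ t → coeff (antidiagonal f n) t ≡ 0ℚ
coeff-antidiagonal-≥ f {zero}  _         = refl
coeff-antidiagonal-≥ f {suc n} (s≤s n≤t) = coeff-antidiagonal-≥ (λ t → f (suc t)) n≤t

-- Coefficients of P_{2K} in the basis x(x+1)⋯(x+t-1).
E : ℕ → Poly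
E = antidiagonal coeffE

E-≥ : ∀ K t → K ≤ t → coeff (E K) t ≡ 0ℚ
E-≥ K t = coeff-antidiagonal-≥ coeffE {K} {t}

-- The closed form of P_{2K}.
evenForm : ℕ → Poly
evenForm K = rising 0 (E K)

coeff-unit-self : ∀ k → coeff (unit k) k ≡ 1ℚ
coeff-unit-self zero    = refl
coeff-unit-self (suc k) = coeff-unit-self k

coeff-unit-< : ∀ {k t} → t < k → coeff (unit k) t ≡ 0ℚ
coeff-unit-< {suc k} {zero}  _         = refl
coeff-unit-< {suc k} {suc t} (s≤s t<k) = coeff-unit-< t<k

coeff-unit-> : ∀ {k t} → k < t → coeff (unit k) t ≡ 0ℚ
coeff-unit-> {zero}  {suc t} _         = refl
coeff-unit-> {suc k} {suc t} (s≤s k<t) = coeff-unit-> k<t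

unit-support-by : ∀ k t → ℕ.Ordering t k → (q t - q k) * coeff (unit k) t ≡ 0ℚ
unit-support-by .(suc (t ℕ.+ u)) t (ℕ.less .t u) =
  trans (cong ((q t - q (suc (t ℕ.+ u))) *_) (coeff-unit-< {suc (t ℕ.+ u)} {t} (s≤s (ℕP.m≤m+n t u))))
        (ℚP.*-zeroʳ (q t - q (suc (t ℕ.+ u))))
unit-support-by .t t (ℕ.equal .t) =
  trans (cong (_* coeff (unit t) t) (ℚP.+-inverseʳ (q t))) (ℚP.*-zeroˡ (coeff (unit t) t))
unit-support-by k .(suc (k ℕ.+ m)) (ℕ.greater .k m) =
  trans (cong ((q (suc (k ℕ.+ m)) - q k) *_) (coeff-unit-> {k} {suc (k ℕ.+ m)} (s≤s (ℕP.m≤m+n k m))))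
        (ℚP.*-zeroʳ (q (suc (k ℕ.+ m)) - q k))

unit-support : ∀ k t → (q t - q k) * coeff (unit k) t ≡ 0ℚ
unit-support k t = unit-support-by k t (ℕ.compare t k)

-- The closed form of P_{2K+1}.
oddForm : ℕ → Poly
oddForm K = padd (pmulLin (q 2) (q (4 ℕ.* K)) (evenForm K)) (prodFrom 0 K)

O : ℕ → Poly
O K = padd (mulLinBasis 0 (q 2) (q (4 ℕ.* K)) (E K)) (unit K)

coeff-O : ∀ K t → coeff (O K) t ≡ q 2 * coeff (0ℚ ∷ E K) t + q 2 * (q 2 * q K - q t) * coeff (E K) t + coeff (unit K) t
coeff-O K t = begin
  coeff (O K) t
    ≡⟨ coeff-padd (mulLinBasis 0 (q 2) (q (4 ℕ.* K)) (E K)) (unit K) t ⟩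
  coeff (mulLinBasis 0 (q 2) (q (4 ℕ.* K)) (E K)) t + coeff (unit K) t
    ≡⟨ cong (_+ coeff (unit K) t) (coeff-mulLinBasis 0 (q 2) (q (4 ℕ.* K)) (E K) t) ⟩
  q 2 * (coeff (0ℚ ∷ E K) t - q t * coeff (E K) t) + q (4 ℕ.* K) * coeff (E K) t + coeff (unit K) t
    ≡⟨ cong (λ w → q 2 * (coeff (0ℚ ∷ E K) t - q t * coeff (E K) t) + w * coeff (E K) t + coeff (unit K) t) (q-* 4 K) ⟩
  q 2 * (coeff (0ℚ ∷ E K) t - q t * coeff (E K) t) + q 4 * q K * coeff (E K) t + coeff (unit K) t
    ≡⟨ regroup (q K) (q t) (coeff (0ℚ ∷ E K) t) (coeff (E K) t) (coeff (unit K) t) ⟩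
  q 2 * coeff (0ℚ ∷ E K) t + q 2 * (q 2 * q K - q t) * coeff (E K) t + coeff (unit K) t ∎
  where
  open ≡-Reasoning
  regroup : ∀ κ τ p a δ → q 2 * (p - τ * a) + q 4 * κ * a + δ ≡ q 2 * p + q 2 * (q 2 * κ - τ) * a + δ
  regroup = solve 5 (λ κ τ p a δ →
      (Κ (q 2) :* (p :+ ⊝ (τ :* a)) :+ Κ (q 4) :* κ :* a :+ δ)
    ⊜ (Κ (q 2) :* p :+ Κ (q 2) :* (Κ (q 2) :* κ :+ ⊝ τ) :* a :+ δ)) refl

oddForm-rising : ∀ K → oddForm K ≈ rising 0 (O K)
oddForm-rising K = begin
  padd (pmulLin (q 2) (q (4 ℕ.* K)) (rising 0 (E K))) (prodFrom 0 K)
    ≈⟨ padd-cong (rising-pmulLin 0 (q 2) (q (4 ℕ.* K)) (E K)) (≈-sym (rising-unit 0 K)) ⟩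
  padd (rising 0 (mulLinBasis 0 (q 2) (q (4 ℕ.* K)) (E K))) (rising 0 (unit K))
    ≈⟨ rising-padd 0 (mulLinBasis 0 (q 2) (q (4 ℕ.* K)) (E K)) (unit K) ⟨
  rising 0 (O K) ∎
  where open ≈-Reasoning

-- Relations between neighbouring coefficients

-- With κ = K and τ = t: ERec links the entries t and t + 1 of E K, LiftRecˡ and LiftRecʳ link
-- E (K + 1) to E K, ORec links the entries t and t + 1 of O K, and OERec links O K to E (K + 1).
-- A primed relation is the unprimed one moved down by one index.
ERec : ℚ → ℚ → ℚ → ℚ → ℚ → Set
ERec κ τ x₀ x₁ δ = (q 2 * κ - q 2 * τ - 1ℚ) * x₀ ≡ q 2 * (1ℚ + τ) * (q 2 * κ - τ - 1ℚ) * x₁ + κ * δ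

ERec-zeros : ∀ κ τ {x₀ x₁ δ} → x₀ ≡ 0ℚ → x₁ ≡ 0ℚ → δ ≡ 0ℚ → ERec κ τ x₀ x₁ δ
ERec-zeros κ τ refl refl refl = solve 2 (λ κ τ →
      ((Κ (q 2) :* κ :+ ⊝ (Κ (q 2) :* τ) :+ ⊝ Κ 1ℚ) :* Κ 0ℚ)
    ⊜ (Κ (q 2) :* (Κ 1ℚ :+ τ) :* (Κ (q 2) :* κ :+ ⊝ τ :+ ⊝ Κ 1ℚ) :* Κ 0ℚ :+ κ :* Κ 0ℚ)) refl κ τ

ERec-resp : ∀ κ τ {x₀ x₁ δ x₀′ x₁′ δ′} → x₀ ≡ x₀′ → x₁ ≡ x₁′ → δ ≡ δ′ → ERec κ τ x₀′ x₁′ δ′ → ERec κ τ x₀ x₁ δ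
ERec-resp κ τ refl refl refl rec = rec

e-rec-by : ∀ K t → ℕ.Ordering t K → ERec (q K) (q t) (coeff (E K) t) (coeff (E K) (suc t)) (coeff (unit K) (suc t))
e-rec-by .(suc (t ℕ.+ 0)) t (ℕ.less .t zero) =
  ERec-resp (q (suc (t ℕ.+ 0))) (q t) (trans (coeff-antidiagonal coeffE t 0 refl) (coeffE-zero t))
            (E-≥ (suc (t ℕ.+ 0)) (suc t) (s≤s (ℕP.≤-reflexive (ℕP.+-identityʳ t))))
            (trans (cong (λ k → coeff (unit k) (suc t)) (cong suc (ℕP.+-identityʳ t))) (coeff-unit-self (suc t)))
            (top-rec (q (suc (t ℕ.+ 0))) (q t) (trans (cong q (cong suc (ℕP.+-identityʳ t))) (q-suc t)))
  where
  top-rec : ∀ κ τ → κ ≡ 1ℚ + τ → ERec κ τ (1ℚ + τ) 0ℚ 1ℚ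
  top-rec _ τ refl = solve 1 (λ τ →
        ((Κ (q 2) :* (Κ 1ℚ :+ τ) :+ ⊝ (Κ (q 2) :* τ) :+ ⊝ Κ 1ℚ) :* (Κ 1ℚ :+ τ))
      ⊜ (Κ (q 2) :* (Κ 1ℚ :+ τ) :* (Κ (q 2) :* (Κ 1ℚ :+ τ) :+ ⊝ τ :+ ⊝ Κ 1ℚ) :* Κ 0ℚ
          :+ (Κ 1ℚ :+ τ) :* Κ 1ℚ)) refl τ
e-rec-by .(suc (t ℕ.+ suc u)) t (ℕ.less .t (suc u)) =
  ERec-resp (q (suc (t ℕ.+ suc u))) (q t) (coeff-antidiagonal coeffE t (suc u) refl)
            (coeff-antidiagonal coeffE (suc t) u (cong suc (ℕP.+-suc t u)))
            (coeff-unit-< {suc (t ℕ.+ suc u)} {suc t} (s≤s (ℕP.m<m+n t ℕ.z<s)))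
            (inner-rec (q (suc (t ℕ.+ suc u))) (q t) (q u) (coeffE t (suc u)) (coeffE t u) (coeffE (suc t) u)
                       (q-affine 2 t 1 u (shape t u)) (coeffE-sucʳ t u) (coeffE-sucˡ t u))
  where
  shape : ∀ t u → suc (t ℕ.+ suc u) ≡ 2 ℕ.+ t ℕ.+ 1 ℕ.* u
  shape = ℕSolver.solve-∀
  inner-rec : ∀ κ τ υ x₃ x₁ y → κ ≡ q 2 + τ + q 1 * υ →
    (q 3 + q 2 * υ) * x₃ ≡ q 2 * (q 3 + τ + q 2 * υ) * (q 2 + τ + q 2 * υ) * x₁ →
    (1ℚ + τ) * y ≡ (q 2 + τ + q 2 * υ) * x₁ →
    ERec κ τ x₃ y 0ℚ
  inner-rec _ τ υ x₃ x₁ y refl h₂ h₁ =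
    combine (h₂ ⊕ - (q 2 * (q 3 + τ + q 2 * υ)) ⊙ h₁) (identity τ υ x₃ x₁ y)
    where
    identity : ∀ τ υ x₃ x₁ y →
      ((q 2 * (q 2 + τ + q 1 * υ) - q 2 * τ - 1ℚ) * x₃)
        - (q 2 * (1ℚ + τ) * (q 2 * (q 2 + τ + q 1 * υ) - τ - 1ℚ) * y + (q 2 + τ + q 1 * υ) * 0ℚ)
        ≡ (((q 3 + q 2 * υ) * x₃) + (- (q 2 * (q 3 + τ + q 2 * υ))) * ((1ℚ + τ) * y))
          - ((q 2 * (q 3 + τ + q 2 * υ) * (q 2 + τ + q 2 * υ) * x₁) + (- (q 2 * (q 3 + τ + q 2 * υ))) * ((q 2 + τ + q 2 * υ) * x₁))
    identity = solve 5 (λ τ υ x₃ x₁ y →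
        ((Κ (q 2) :* (Κ (q 2) :+ τ :+ Κ (q 1) :* υ) :+ ⊝ (Κ (q 2) :* τ) :+ ⊝ Κ 1ℚ) :* x₃
          :+ ⊝ (Κ (q 2) :* (Κ 1ℚ :+ τ) :* (Κ (q 2) :* (Κ (q 2) :+ τ :+ Κ (q 1) :* υ) :+ ⊝ τ :+ ⊝ Κ 1ℚ) :* y :+ (Κ (q 2) :+ τ :+ Κ (q 1) :* υ) :* Κ 0ℚ))
      ⊜ ((Κ (q 3) :+ Κ (q 2) :* υ) :* x₃
          :+ ⊝ (Κ (q 2) :* (Κ (q 3) :+ τ :+ Κ (q 2) :* υ)) :* ((Κ 1ℚ :+ τ) :* y)
          :+ ⊝ (Κ (q 2) :* (Κ (q 3) :+ τ :+ Κ (q 2) :* υ) :* (Κ (q 2) :+ τ :+ Κ (q 2) :* υ) :* x₁ :+ ⊝ (Κ (q 2) :* (Κ (q 3) :+ τ :+ Κ (q 2) :* υ)) :* ((Κ (q 2) :+ τ :+ Κ (q 2) :* υ) :* x₁)))) refl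
e-rec-by .t t (ℕ.equal .t) =
  ERec-zeros (q t) (q t) (E-≥ t t ℕP.≤-refl) (E-≥ t (suc t) (ℕP.n≤1+n t)) (coeff-unit-> {t} {suc t} (ℕP.n<1+n t))
e-rec-by K .(suc (K ℕ.+ k)) (ℕ.greater .K k) =
  ERec-zeros (q K) (q (suc (K ℕ.+ k))) (E-≥ K (suc (K ℕ.+ k)) K≤t) (E-≥ K (suc (suc (K ℕ.+ k))) (ℕP.m≤n⇒m≤1+n K≤t))
             (coeff-unit-> {K} {suc (suc (K ℕ.+ k))} (s≤s K≤t))
  where K≤t = ℕP.m≤n⇒m≤1+n (ℕP.m≤m+n K k)

e-rec : ∀ K t → ERec (q K) (q t) (coeff (E K) t) (coeff (E K) (suc t)) (coeff (unit K) (suc t))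
e-rec K t = e-rec-by K t (ℕ.compare t K)

LiftRecˡ : ℚ → ℚ → ℚ → ℚ → Set
LiftRecˡ κ τ y x = τ * y ≡ (q 2 * κ + 1ℚ - τ) * x

LiftRecˡ-zeros : ∀ κ τ {y x} → y ≡ 0ℚ → x ≡ 0ℚ → LiftRecˡ κ τ y x
LiftRecˡ-zeros κ τ refl refl = solve 2 (λ κ τ →
      (τ :* Κ 0ℚ)
    ⊜ ((Κ (q 2) :* κ :+ Κ 1ℚ :+ ⊝ τ) :* Κ 0ℚ)) refl κ τ

LiftRecˡ-resp : ∀ κ τ {y x y′ x′} → y ≡ y′ → x ≡ x′ → LiftRecˡ κ τ y′ x′ → LiftRecˡ κ τ y x
LiftRecˡ-resp κ τ refl refl rec = rec

lift-recˡ-suc-by : ∀ K s → ℕ.Ordering s K → LiftRecˡ (q K) (q (suc s)) (coeff (E (suc K)) (suc s)) (coeff (E K) s)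
lift-recˡ-suc-by .(suc (s ℕ.+ u)) s (ℕ.less .s u) =
  LiftRecˡ-resp (q (suc (s ℕ.+ u))) (q (suc s)) (coeff-antidiagonal coeffE (suc s) u refl) (coeff-antidiagonal coeffE s u refl)
            (algebra (q (suc (s ℕ.+ u))) (q s) (q u) (q (suc s)) (coeffE (suc s) u) (coeffE s u)
                     (q-affine 1 s 1 u (shape s u)) (q-suc s) (coeffE-sucˡ s u))
  where
  shape : ∀ s u → suc (s ℕ.+ u) ≡ 1 ℕ.+ s ℕ.+ 1 ℕ.* u
  shape = ℕSolver.solve-∀
  algebra : ∀ κ σ υ τ y x → κ ≡ q 1 + σ + q 1 * υ → τ ≡ 1ℚ + σ →
            (1ℚ + σ) * y ≡ (q 2 + σ + q 2 * υ) * x → LiftRecˡ κ τ y x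
  algebra _ σ υ _ y x refl refl h = combine h (identity σ υ y x)
    where
    identity : ∀ σ υ y x →
      ((1ℚ + σ) * y) - ((q 2 * (q 1 + σ + q 1 * υ) + 1ℚ - (1ℚ + σ)) * x)
        ≡ ((1ℚ + σ) * y) - ((q 2 + σ + q 2 * υ) * x)
    identity = solve 4 (λ σ υ y x →
        ((Κ 1ℚ :+ σ) :* y
          :+ ⊝ ((Κ (q 2) :* (Κ (q 1) :+ σ :+ Κ (q 1) :* υ) :+ Κ 1ℚ :+ ⊝ (Κ 1ℚ :+ σ)) :* x))
      ⊜ ((Κ 1ℚ :+ σ) :* y :+ ⊝ ((Κ (q 2) :+ σ :+ Κ (q 2) :* υ) :* x))) refl
lift-recˡ-suc-by .s s (ℕ.equal .s) = LiftRecˡ-zeros (q s) (q (suc s)) (E-≥ (suc s) (suc s) ℕP.≤-refl) (E-≥ s s ℕP.≤-refl)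
lift-recˡ-suc-by K .(suc (K ℕ.+ k)) (ℕ.greater .K k) = LiftRecˡ-zeros (q K) (q (suc (suc (K ℕ.+ k)))) (E-≥ (suc K) (suc (suc (K ℕ.+ k))) (s≤s K≤s)) (E-≥ K (suc (K ℕ.+ k)) K≤s)
  where K≤s = ℕP.m≤n⇒m≤1+n (ℕP.m≤m+n K k)

lift-recˡ : ∀ K t → LiftRecˡ (q K) (q t) (coeff (E (suc K)) t) (coeff (0ℚ ∷ E K) t)
lift-recˡ K zero = first (q K) (coeff (E (suc K)) 0)
  where
  first : ∀ κ y → LiftRecˡ κ (q 0) y 0ℚ
  first κ y = solve 2 (λ κ y →
        (Κ (q 0) :* y)
      ⊜ ((Κ (q 2) :* κ :+ Κ 1ℚ :+ ⊝ Κ (q 0)) :* Κ 0ℚ)) refl κ y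
lift-recˡ K (suc s) = lift-recˡ-suc-by K s (ℕ.compare s K)

LiftRecʳ : ℚ → ℚ → ℚ → ℚ → ℚ → Set
LiftRecʳ κ τ y x δ = (q 2 * κ + 1ℚ - q 2 * τ) * y ≡ q 2 * (q 2 * κ + 1ℚ - τ) * (q 2 * κ - τ) * x + (κ + 1ℚ) * δ

LiftRecʳ-resp : ∀ κ τ {y x δ y′ x′ δ′} → y ≡ y′ → x ≡ x′ → δ ≡ δ′ → LiftRecʳ κ τ y′ x′ δ′ → LiftRecʳ κ τ y x δ
LiftRecʳ-resp κ τ refl refl refl rec = rec

lift-recʳ-by : ∀ K t → ℕ.Ordering t K → LiftRecʳ (q K) (q t) (coeff (E (suc K)) t) (coeff (E K) t) (coeff (unit K) t)
lift-recʳ-by .(suc (t ℕ.+ u)) t (ℕ.less .t u) =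
  LiftRecʳ-resp (q (suc (t ℕ.+ u))) (q t) (coeff-antidiagonal coeffE t (suc u) (cong suc (sym (ℕP.+-suc t u))))
             (coeff-antidiagonal coeffE t u refl) (coeff-unit-< {suc (t ℕ.+ u)} {t} (s≤s (ℕP.m≤m+n t u)))
             (algebra (q (suc (t ℕ.+ u))) (q t) (q u) (coeffE t (suc u)) (coeffE t u) (q-affine 1 t 1 u (shape t u)) (coeffE-sucʳ t u))
  where
  shape : ∀ t u → suc (t ℕ.+ u) ≡ 1 ℕ.+ t ℕ.+ 1 ℕ.* u
  shape = ℕSolver.solve-∀
  algebra : ∀ κ τ υ y x → κ ≡ q 1 + τ + q 1 * υ →
            (q 3 + q 2 * υ) * y ≡ q 2 * (q 3 + τ + q 2 * υ) * (q 2 + τ + q 2 * υ) * x → LiftRecʳ κ τ y x 0ℚ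
  algebra _ τ υ y x refl h = combine h (identity τ υ y x)
    where
    identity : ∀ τ υ y x →
      ((q 2 * (q 1 + τ + q 1 * υ) + 1ℚ - q 2 * τ) * y)
        - (q 2 * (q 2 * (q 1 + τ + q 1 * υ) + 1ℚ - τ) * (q 2 * (q 1 + τ + q 1 * υ) - τ) * x + ((q 1 + τ + q 1 * υ) + 1ℚ) * 0ℚ)
        ≡ ((q 3 + q 2 * υ) * y) - (q 2 * (q 3 + τ + q 2 * υ) * (q 2 + τ + q 2 * υ) * x)
    identity = solve 4 (λ τ υ y x →
        ((Κ (q 2) :* (Κ (q 1) :+ τ :+ Κ (q 1) :* υ) :+ Κ 1ℚ :+ ⊝ (Κ (q 2) :* τ)) :* y
          :+ ⊝ (Κ (q 2) :* (Κ (q 2) :* (Κ (q 1) :+ τ :+ Κ (q 1) :* υ) :+ Κ 1ℚ :+ ⊝ τ) :* (Κ (q 2) :* (Κ (q 1) :+ τ :+ Κ (q 1) :* υ) :+ ⊝ τ) :* x :+ (Κ (q 1) :+ τ :+ Κ (q 1) :* υ :+ Κ 1ℚ) :* Κ 0ℚ))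
      ⊜ ((Κ (q 3) :+ Κ (q 2) :* υ) :* y
          :+ ⊝ (Κ (q 2) :* (Κ (q 3) :+ τ :+ Κ (q 2) :* υ) :* (Κ (q 2) :+ τ :+ Κ (q 2) :* υ) :* x))) refl
lift-recʳ-by .t t (ℕ.equal .t) =
  LiftRecʳ-resp (q t) (q t) (trans (coeff-antidiagonal coeffE t 0 (cong suc (sym (ℕP.+-identityʳ t)))) (coeffE-zero t))
             (E-≥ t t ℕP.≤-refl) (coeff-unit-self t) (top (q t))
  where
  top : ∀ κ → LiftRecʳ κ κ (1ℚ + κ) 0ℚ 1ℚ
  top κ = solve 1 (λ κ →
        ((Κ (q 2) :* κ :+ Κ 1ℚ :+ ⊝ (Κ (q 2) :* κ)) :* (Κ 1ℚ :+ κ))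
      ⊜ (Κ (q 2) :* (Κ (q 2) :* κ :+ Κ 1ℚ :+ ⊝ κ) :* (Κ (q 2) :* κ :+ ⊝ κ) :* Κ 0ℚ
          :+ (κ :+ Κ 1ℚ) :* Κ 1ℚ)) refl κ
lift-recʳ-by K .(suc (K ℕ.+ k)) (ℕ.greater .K k) =
  LiftRecʳ-resp (q K) (q t) (E-≥ (suc K) t (s≤s (ℕP.m≤m+n K k))) (E-≥ K t (ℕP.m≤n⇒m≤1+n (ℕP.m≤m+n K k)))
             (coeff-unit-> {K} {t} (s≤s (ℕP.m≤m+n K k))) (zeros (q K) (q t))
  where
  t = suc (K ℕ.+ k)
  zeros : ∀ κ τ → LiftRecʳ κ τ 0ℚ 0ℚ 0ℚ
  zeros κ τ = solve 2 (λ κ τ →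
        ((Κ (q 2) :* κ :+ Κ 1ℚ :+ ⊝ (Κ (q 2) :* τ)) :* Κ 0ℚ)
      ⊜ (Κ (q 2) :* (Κ (q 2) :* κ :+ Κ 1ℚ :+ ⊝ τ) :* (Κ (q 2) :* κ :+ ⊝ τ) :* Κ 0ℚ
          :+ (κ :+ Κ 1ℚ) :* Κ 0ℚ)) refl κ τ

lift-recʳ : ∀ K t → LiftRecʳ (q K) (q t) (coeff (E (suc K)) t) (coeff (E K) t) (coeff (unit K) t)
lift-recʳ K t = lift-recʳ-by K t (ℕ.compare t K)

ERec′ : ℚ → ℚ → ℚ → ℚ → ℚ → Set
ERec′ κ τ p x δ = (q 2 * κ - q 2 * τ + 1ℚ) * p ≡ q 2 * τ * (q 2 * κ - τ) * x + κ * δ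

e-rec′ : ∀ K t → ERec′ (q K) (q t) (coeff (0ℚ ∷ E K) t) (coeff (E K) t) (coeff (unit K) t)
e-rec′ K zero    = first (q K) (coeff (E K) 0) (unit-support K 0)
  where
  first : ∀ κ x {δ} → (q 0 - κ) * δ ≡ 0ℚ → ERec′ κ (q 0) 0ℚ x δ
  first κ x {δ} h = combine h (identity κ x δ)
    where
    identity : ∀ κ x δ →
      ((q 2 * κ - q 2 * q 0 + 1ℚ) * 0ℚ) - (q 2 * q 0 * (q 2 * κ - q 0) * x + κ * δ)
        ≡ ((q 0 - κ) * δ) - 0ℚ
    identity = solve 3 (λ κ x δ →
        ((Κ (q 2) :* κ :+ ⊝ (Κ (q 2) :* Κ (q 0)) :+ Κ 1ℚ) :* Κ 0ℚ
          :+ ⊝ (Κ (q 2) :* Κ (q 0) :* (Κ (q 2) :* κ :+ ⊝ Κ (q 0)) :* x :+ κ :* δ))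
      ⊜ ((Κ (q 0) :+ ⊝ κ) :* δ :+ ⊝ Κ 0ℚ)) refl
e-rec′ K (suc s) = shift (q K) (q s) (q (suc s)) (q-suc s) (e-rec K s)
  where
  shift : ∀ κ σ τ {x₀ x₁ δ} → τ ≡ 1ℚ + σ → ERec κ σ x₀ x₁ δ → ERec′ κ τ x₀ x₁ δ
  shift κ σ _ {x₀} {x₁} {δ} refl h = combine h (identity κ σ x₀ x₁ δ)
    where
    identity : ∀ κ σ x₀ x₁ δ →
      ((q 2 * κ - q 2 * (1ℚ + σ) + 1ℚ) * x₀) - (q 2 * (1ℚ + σ) * (q 2 * κ - (1ℚ + σ)) * x₁ + κ * δ)
        ≡ ((q 2 * κ - q 2 * σ - 1ℚ) * x₀) - (q 2 * (1ℚ + σ) * (q 2 * κ - σ - 1ℚ) * x₁ + κ * δ)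
    identity = solve 5 (λ κ σ x₀ x₁ δ →
        ((Κ (q 2) :* κ :+ ⊝ (Κ (q 2) :* (Κ 1ℚ :+ σ)) :+ Κ 1ℚ) :* x₀
          :+ ⊝ (Κ (q 2) :* (Κ 1ℚ :+ σ) :* (Κ (q 2) :* κ :+ ⊝ (Κ 1ℚ :+ σ)) :* x₁ :+ κ :* δ))
      ⊜ ((Κ (q 2) :* κ :+ ⊝ (Κ (q 2) :* σ) :+ ⊝ Κ 1ℚ) :* x₀
          :+ ⊝ (Κ (q 2) :* (Κ 1ℚ :+ σ) :* (Κ (q 2) :* κ :+ ⊝ σ :+ ⊝ Κ 1ℚ) :* x₁ :+ κ :* δ))) refl

ORec : ℚ → ℚ → ℚ → ℚ → ℚ → Set
ORec κ τ x₀ x₁ δ = (q 2 * κ - q 2 * τ + 1ℚ) * x₀ ≡ q 2 * (1ℚ + τ) * (q 2 * κ - τ) * x₁ + (q 2 * κ + 1ℚ) * δ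

o-rec : ∀ K t → ORec (q K) (q t) (coeff (O K) t) (coeff (O K) (suc t)) (coeff (unit K) t)
o-rec K t =
  subst₂ (λ x₀ x₁ → ORec (q K) (q t) x₀ x₁ (coeff (unit K) t)) (sym (coeff-O K t))
         (sym (trans (coeff-O K (suc t)) (cong (λ τ → q 2 * a₀ + q 2 * (q 2 * q K - τ) * a₁ + δ₁) (q-suc t))))
         (algebra (q K) (q t) (coeff (0ℚ ∷ E K) t) a₀ a₁ (coeff (unit K) t) δ₁
                  (e-rec′ K t) (e-rec K t) (unit-support K t)
                  (trans (cong (λ τ → (τ - q K) * δ₁) (sym (q-suc t))) (unit-support K (suc t))))
  where
  a₀ = coeff (E K) t
  a₁ = coeff (E K) (suc t)
  δ₁ = coeff (unit K) (suc t)
  algebra : ∀ κ τ p a₀ a₁ δ₀ δ₁ → ERec′ κ τ p a₀ δ₀ → ERec κ τ a₀ a₁ δ₁ →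
            (τ - κ) * δ₀ ≡ 0ℚ → (1ℚ + τ - κ) * δ₁ ≡ 0ℚ →
            ORec κ τ (q 2 * p + q 2 * (q 2 * κ - τ) * a₀ + δ₀) (q 2 * a₀ + q 2 * (q 2 * κ - (1ℚ + τ)) * a₁ + δ₁) δ₀
  algebra κ τ p a₀ a₁ δ₀ δ₁ h′ h s₀ s₁ =
    combine (q 2 ⊙ h′ ⊕ q 2 * (q 2 * κ - τ) ⊙ h ⊕ - q 2 ⊙ s₀ ⊕ - (q 2 * (q 2 * κ - τ)) ⊙ s₁)
      (identity κ τ p a₀ a₁ δ₀ δ₁)
    where
    identity : ∀ κ τ p a₀ a₁ δ₀ δ₁ →
      ((q 2 * κ - q 2 * τ + 1ℚ) * (q 2 * p + q 2 * (q 2 * κ - τ) * a₀ + δ₀))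
        - (q 2 * (1ℚ + τ) * (q 2 * κ - τ) * (q 2 * a₀ + q 2 * (q 2 * κ - (1ℚ + τ)) * a₁ + δ₁) + (q 2 * κ + 1ℚ) * δ₀)
        ≡ (q 2 * ((q 2 * κ - q 2 * τ + 1ℚ) * p) + (q 2 * (q 2 * κ - τ)) * ((q 2 * κ - q 2 * τ - 1ℚ) * a₀) + (- q 2) * ((τ - κ) * δ₀) + (- (q 2 * (q 2 * κ - τ))) * ((1ℚ + τ - κ) * δ₁))
          - (q 2 * (q 2 * τ * (q 2 * κ - τ) * a₀ + κ * δ₀) + (q 2 * (q 2 * κ - τ)) * (q 2 * (1ℚ + τ) * (q 2 * κ - τ - 1ℚ) * a₁ + κ * δ₁) + (- q 2) * 0ℚ + (- (q 2 * (q 2 * κ - τ))) * 0ℚ)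
    identity = solve 7 (λ κ τ p a₀ a₁ δ₀ δ₁ →
        ((Κ (q 2) :* κ :+ ⊝ (Κ (q 2) :* τ) :+ Κ 1ℚ) :* (Κ (q 2) :* p :+ Κ (q 2) :* (Κ (q 2) :* κ :+ ⊝ τ) :* a₀ :+ δ₀)
          :+ ⊝ (Κ (q 2) :* (Κ 1ℚ :+ τ) :* (Κ (q 2) :* κ :+ ⊝ τ) :* (Κ (q 2) :* a₀ :+ Κ (q 2) :* (Κ (q 2) :* κ :+ ⊝ (Κ 1ℚ :+ τ)) :* a₁ :+ δ₁) :+ (Κ (q 2) :* κ :+ Κ 1ℚ) :* δ₀))
      ⊜ (Κ (q 2) :* ((Κ (q 2) :* κ :+ ⊝ (Κ (q 2) :* τ) :+ Κ 1ℚ) :* p)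
          :+ Κ (q 2) :* (Κ (q 2) :* κ :+ ⊝ τ) :* ((Κ (q 2) :* κ :+ ⊝ (Κ (q 2) :* τ) :+ ⊝ Κ 1ℚ) :* a₀)
          :+ ⊝ Κ (q 2) :* ((τ :+ ⊝ κ) :* δ₀)
          :+ ⊝ (Κ (q 2) :* (Κ (q 2) :* κ :+ ⊝ τ)) :* ((Κ 1ℚ :+ τ :+ ⊝ κ) :* δ₁)
          :+ ⊝ (Κ (q 2) :* (Κ (q 2) :* τ :* (Κ (q 2) :* κ :+ ⊝ τ) :* a₀ :+ κ :* δ₀) :+ Κ (q 2) :* (Κ (q 2) :* κ :+ ⊝ τ) :* (Κ (q 2) :* (Κ 1ℚ :+ τ) :* (Κ (q 2) :* κ :+ ⊝ τ :+ ⊝ Κ 1ℚ) :* a₁ :+ κ :* δ₁) :+ ⊝ Κ (q 2) :* Κ 0ℚ :+ ⊝ (Κ (q 2) :* (Κ (q 2) :* κ :+ ⊝ τ)) :* Κ 0ℚ))) refl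

ORec′ : ℚ → ℚ → ℚ → ℚ → ℚ → Set
ORec′ κ τ p x δ = (q 2 * κ - q 2 * τ + q 3) * p ≡ q 2 * τ * (q 2 * κ + 1ℚ - τ) * x + (q 2 * κ + 1ℚ) * δ

o-rec′ : ∀ K t → ORec′ (q K) (q t) (coeff (0ℚ ∷ O K) t) (coeff (O K) t) (coeff (0ℚ ∷ unit K) t)
o-rec′ K zero    = first (q K) (coeff (O K) 0)
  where
  first : ∀ κ x → ORec′ κ (q 0) 0ℚ x 0ℚ
  first κ x = solve 2 (λ κ x →
        ((Κ (q 2) :* κ :+ ⊝ (Κ (q 2) :* Κ (q 0)) :+ Κ (q 3)) :* Κ 0ℚ)
      ⊜ (Κ (q 2) :* Κ (q 0) :* (Κ (q 2) :* κ :+ Κ 1ℚ :+ ⊝ Κ (q 0)) :* x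
          :+ (Κ (q 2) :* κ :+ Κ 1ℚ) :* Κ 0ℚ)) refl κ x
o-rec′ K (suc s) = shift (q K) (q s) (q (suc s)) (q-suc s) (o-rec K s)
  where
  shift : ∀ κ σ τ {x₀ x₁ δ} → τ ≡ 1ℚ + σ → ORec κ σ x₀ x₁ δ → ORec′ κ τ x₀ x₁ δ
  shift κ σ _ {x₀} {x₁} {δ} refl h = combine h (identity κ σ x₀ x₁ δ)
    where
    identity : ∀ κ σ x₀ x₁ δ →
      ((q 2 * κ - q 2 * (1ℚ + σ) + q 3) * x₀)
        - (q 2 * (1ℚ + σ) * (q 2 * κ + 1ℚ - (1ℚ + σ)) * x₁ + (q 2 * κ + 1ℚ) * δ)
        ≡ ((q 2 * κ - q 2 * σ + 1ℚ) * x₀)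
          - (q 2 * (1ℚ + σ) * (q 2 * κ - σ) * x₁ + (q 2 * κ + 1ℚ) * δ)
    identity = solve 5 (λ κ σ x₀ x₁ δ →
        ((Κ (q 2) :* κ :+ ⊝ (Κ (q 2) :* (Κ 1ℚ :+ σ)) :+ Κ (q 3)) :* x₀
          :+ ⊝ (Κ (q 2) :* (Κ 1ℚ :+ σ) :* (Κ (q 2) :* κ :+ Κ 1ℚ :+ ⊝ (Κ 1ℚ :+ σ)) :* x₁ :+ (Κ (q 2) :* κ :+ Κ 1ℚ) :* δ))
      ⊜ ((Κ (q 2) :* κ :+ ⊝ (Κ (q 2) :* σ) :+ Κ 1ℚ) :* x₀
          :+ ⊝ (Κ (q 2) :* (Κ 1ℚ :+ σ) :* (Κ (q 2) :* κ :+ ⊝ σ) :* x₁ :+ (Κ (q 2) :* κ :+ Κ 1ℚ) :* δ))) refl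

OERec : ℚ → ℚ → ℚ → ℚ → Set
OERec κ τ x y = (q 2 * κ + 1ℚ - τ) * x ≡ (q 2 * κ + 1ℚ) * y

o-e-rec : ∀ K t → OERec (q K) (q t) (coeff (O K) t) (coeff (E (suc K)) t)
o-e-rec K t =
  subst (λ x → OERec (q K) (q t) x (coeff (E (suc K)) t)) (sym (coeff-O K t))
        (algebra (q K) (q t) (coeff (0ℚ ∷ E K) t) (coeff (E K) t) (coeff (E (suc K)) t) (coeff (unit K) t)
                 (lift-recˡ K t) (lift-recʳ K t) (unit-support K t))
  where
  algebra : ∀ κ τ p a a′ δ → LiftRecˡ κ τ a′ p → LiftRecʳ κ τ a′ a δ → (τ - κ) * δ ≡ 0ℚ →
            OERec κ τ (q 2 * p + q 2 * (q 2 * κ - τ) * a + δ) a′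
  algebra κ τ p a a′ δ h h′ s =
    combine (- q 2 ⊙ h ⊕ - 1ℚ ⊙ h′ ⊕ - 1ℚ ⊙ s) (identity κ τ p a a′ δ)
    where
    identity : ∀ κ τ p a a′ δ →
      ((q 2 * κ + 1ℚ - τ) * (q 2 * p + q 2 * (q 2 * κ - τ) * a + δ)) - ((q 2 * κ + 1ℚ) * a′)
        ≡ ((- q 2) * (τ * a′) + (- 1ℚ) * ((q 2 * κ + 1ℚ - q 2 * τ) * a′) + (- 1ℚ) * ((τ - κ) * δ))
          - ((- q 2) * ((q 2 * κ + 1ℚ - τ) * p) + (- 1ℚ) * (q 2 * (q 2 * κ + 1ℚ - τ) * (q 2 * κ - τ) * a + (κ + 1ℚ) * δ) + (- 1ℚ) * 0ℚ)
    identity = solve 6 (λ κ τ p a a′ δ →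
        ((Κ (q 2) :* κ :+ Κ 1ℚ :+ ⊝ τ) :* (Κ (q 2) :* p :+ Κ (q 2) :* (Κ (q 2) :* κ :+ ⊝ τ) :* a :+ δ)
          :+ ⊝ ((Κ (q 2) :* κ :+ Κ 1ℚ) :* a′))
      ⊜ (⊝ Κ (q 2) :* (τ :* a′) :+ ⊝ Κ 1ℚ :* ((Κ (q 2) :* κ :+ Κ 1ℚ :+ ⊝ (Κ (q 2) :* τ)) :* a′)
          :+ ⊝ Κ 1ℚ :* ((τ :+ ⊝ κ) :* δ)
          :+ ⊝ (⊝ Κ (q 2) :* ((Κ (q 2) :* κ :+ Κ 1ℚ :+ ⊝ τ) :* p) :+ ⊝ Κ 1ℚ :* (Κ (q 2) :* (Κ (q 2) :* κ :+ Κ 1ℚ :+ ⊝ τ) :* (Κ (q 2) :* κ :+ ⊝ τ) :* a :+ (κ :+ Κ 1ℚ) :* δ) :+ ⊝ Κ 1ℚ :* Κ 0ℚ))) refl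

OERec′ : ℚ → ℚ → ℚ → ℚ → Set
OERec′ κ τ p p′ = (q 2 * κ + q 2 - τ) * p ≡ (q 2 * κ + 1ℚ) * p′

o-e-rec′ : ∀ K t → OERec′ (q K) (q t) (coeff (0ℚ ∷ O K) t) (coeff (0ℚ ∷ E (suc K)) t)
o-e-rec′ K zero    = first (q K)
  where
  first : ∀ κ → OERec′ κ (q 0) 0ℚ 0ℚ
  first κ = solve 1 (λ κ →
        ((Κ (q 2) :* κ :+ Κ (q 2) :+ ⊝ Κ (q 0)) :* Κ 0ℚ)
      ⊜ ((Κ (q 2) :* κ :+ Κ 1ℚ) :* Κ 0ℚ)) refl κ
o-e-rec′ K (suc s) = shift (q K) (q s) (q (suc s)) (q-suc s) (o-e-rec K s)
  where
  shift : ∀ κ σ τ {x y} → τ ≡ 1ℚ + σ → OERec κ σ x y → OERec′ κ τ x y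
  shift κ σ _ {x} {y} refl h = combine h (identity κ σ x y)
    where
    identity : ∀ κ σ x y →
      ((q 2 * κ + q 2 - (1ℚ + σ)) * x) - ((q 2 * κ + 1ℚ) * y)
        ≡ ((q 2 * κ + 1ℚ - σ) * x) - ((q 2 * κ + 1ℚ) * y)
    identity = solve 4 (λ κ σ x y →
        ((Κ (q 2) :* κ :+ Κ (q 2) :+ ⊝ (Κ 1ℚ :+ σ)) :* x :+ ⊝ ((Κ (q 2) :* κ :+ Κ 1ℚ) :* y))
      ⊜ ((Κ (q 2) :* κ :+ Κ 1ℚ :+ ⊝ σ) :* x :+ ⊝ ((Κ (q 2) :* κ :+ Κ 1ℚ) :* y))) refl

-- The polynomial identities behind the recurrence

-- Multiplying by 2x + β before, or by 2x + γ after, the shift x ↦ x + 1 differs by c (x+1)⋯(x+m)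
-- exactly when the coefficients satisfy this two-term relation.
ShiftRec : ℚ → ℚ → ℚ → ℚ → ℚ → ℚ → ℚ → Set
ShiftRec β γ c τ x₀ x₁ δ = (β - q 2 * τ - γ) * x₀ ≡ (1ℚ + τ) * (β - q 2 - q 2 * τ) * x₁ + c * δ

shifted-coeffs : ∀ β γ c m L → (∀ t → ShiftRec β γ c (q t) (coeff L t) (coeff L (suc t)) (coeff (unit m) t)) →
  mulLinBasis 1 (q 2) β (rebase L) ≈ padd (mulLinBasis 1 (q 2) γ L) (pscale c (unit m))
shifted-coeffs β γ c m L rec = coeffwise λ t → begin
  coeff (mulLinBasis 1 (q 2) β (rebase L)) t
    ≡⟨ coeff-mulLinBasis 1 (q 2) β (rebase L) t ⟩
  q 2 * (coeff (0ℚ ∷ rebase L) t - q (suc t) * coeff (rebase L) t) + β * coeff (rebase L) t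
    ≡⟨ cong₂ (λ p x → q 2 * (p - q (suc t) * x) + β * x) (coeff-shift-rebase L t) (coeff-rebase L t) ⟩
  q 2 * ((coeff (0ℚ ∷ L) t - q t * coeff L t) - q (suc t) * (coeff L t - q (suc t) * coeff L (suc t)))
    + β * (coeff L t - q (suc t) * coeff L (suc t))
    ≡⟨ cong (λ τ′ → q 2 * ((coeff (0ℚ ∷ L) t - q t * coeff L t) - τ′ * (coeff L t - τ′ * coeff L (suc t)))
                      + β * (coeff L t - τ′ * coeff L (suc t))) (q-suc t) ⟩
  q 2 * ((coeff (0ℚ ∷ L) t - q t * coeff L t) - (1ℚ + q t) * (coeff L t - (1ℚ + q t) * coeff L (suc t)))
    + β * (coeff L t - (1ℚ + q t) * coeff L (suc t))
    ≡⟨ algebra (q t) (coeff (0ℚ ∷ L) t) (coeff L t) (coeff L (suc t)) (coeff (unit m) t) (rec t) ⟩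
  (q 2 * (coeff (0ℚ ∷ L) t - (1ℚ + q t) * coeff L t) + γ * coeff L t) + c * coeff (unit m) t
    ≡⟨ cong (λ τ′ → (q 2 * (coeff (0ℚ ∷ L) t - τ′ * coeff L t) + γ * coeff L t) + c * coeff (unit m) t) (q-suc t) ⟨
  (q 2 * (coeff (0ℚ ∷ L) t - q (suc t) * coeff L t) + γ * coeff L t) + c * coeff (unit m) t
    ≡⟨ cong₂ _+_ (coeff-mulLinBasis 1 (q 2) γ L t) (coeff-pscale c (unit m) t) ⟨
  coeff (mulLinBasis 1 (q 2) γ L) t + coeff (pscale c (unit m)) t
    ≡⟨ coeff-padd (mulLinBasis 1 (q 2) γ L) (pscale c (unit m)) t ⟨
  coeff (padd (mulLinBasis 1 (q 2) γ L) (pscale c (unit m))) t ∎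
  where
  open ≡-Reasoning
  algebra : ∀ τ p x₀ x₁ δ → ShiftRec β γ c τ x₀ x₁ δ →
    q 2 * ((p - τ * x₀) - (1ℚ + τ) * (x₀ - (1ℚ + τ) * x₁)) + β * (x₀ - (1ℚ + τ) * x₁)
      ≡ (q 2 * (p - (1ℚ + τ) * x₀) + γ * x₀) + c * δ
  algebra τ p x₀ x₁ δ h = combine h (identity τ p x₀ x₁ δ β γ c)
    where
    identity : ∀ τ p x₀ x₁ δ β γ c →
      (q 2 * ((p - τ * x₀) - (1ℚ + τ) * (x₀ - (1ℚ + τ) * x₁)) + β * (x₀ - (1ℚ + τ) * x₁))
        - ((q 2 * (p - (1ℚ + τ) * x₀) + γ * x₀) + c * δ)
        ≡ ((β - q 2 * τ - γ) * x₀) - ((1ℚ + τ) * (β - q 2 - q 2 * τ) * x₁ + c * δ)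
    identity = solve 8 (λ τ p x₀ x₁ δ β γ c →
        (Κ (q 2) :* (p :+ ⊝ (τ :* x₀) :+ ⊝ ((Κ 1ℚ :+ τ) :* (x₀ :+ ⊝ ((Κ 1ℚ :+ τ) :* x₁))))
          :+ β :* (x₀ :+ ⊝ ((Κ 1ℚ :+ τ) :* x₁))
          :+ ⊝ (Κ (q 2) :* (p :+ ⊝ ((Κ 1ℚ :+ τ) :* x₀)) :+ γ :* x₀ :+ c :* δ))
      ⊜ ((β :+ ⊝ (Κ (q 2) :* τ) :+ ⊝ γ) :* x₀
          :+ ⊝ ((Κ 1ℚ :+ τ) :* (β :+ ⊝ Κ (q 2) :+ ⊝ (Κ (q 2) :* τ)) :* x₁ :+ c :* δ))) refl

shifted-identity : ∀ β γ c m L → (∀ t → ShiftRec β γ c (q t) (coeff L t) (coeff L (suc t)) (coeff (unit m) t)) →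
  pmulLin (q 2) β (rising 0 L) ≈ padd (pmulLin (q 2) γ (pshift1 (rising 0 L))) (pscale c (prodFrom 1 m))
shifted-identity β γ c m L rec = begin
  pmulLin (q 2) β (rising 0 L)
    ≈⟨ pmulLin-cong (q 2) β (rising-rebase 0 L) ⟩
  pmulLin (q 2) β (rising 1 (rebase L))
    ≈⟨ rising-pmulLin 1 (q 2) β (rebase L) ⟩
  rising 1 (mulLinBasis 1 (q 2) β (rebase L))
    ≈⟨ rising-cong 1 (shifted-coeffs β γ c m L rec) ⟩
  rising 1 (padd (mulLinBasis 1 (q 2) γ L) (pscale c (unit m)))
    ≈⟨ rising-padd 1 (mulLinBasis 1 (q 2) γ L) (pscale c (unit m)) ⟩
  padd (rising 1 (mulLinBasis 1 (q 2) γ L)) (rising 1 (pscale c (unit m)))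
    ≈⟨ padd-cong (≈-sym (rising-pmulLin 1 (q 2) γ L)) (≈-trans (rising-pscale 1 c (unit m)) (pscale-cong c (rising-unit 1 m))) ⟩
  padd (pmulLin (q 2) γ (rising 1 L)) (pscale c (prodFrom 1 m))
    ≈⟨ padd-cong (pmulLin-cong (q 2) γ (≈-sym (pshift1-rising 0 L))) (≈-refl {pscale c (prodFrom 1 m)}) ⟩
  padd (pmulLin (q 2) γ (pshift1 (rising 0 L))) (pscale c (prodFrom 1 m)) ∎
  where open ≈-Reasoning

evenForm-shift : ∀ k → let K = suc k in
  pmulLin (q 2) (q 4 * q K) (evenForm K)
    ≈ padd (pmulLin (q 2) (q 2 * q K + 1ℚ) (pshift1 (evenForm K))) (pscale (q K) (prodFrom 1 k))
evenForm-shift k = shifted-identity _ _ (q (suc k)) k (E (suc k)) λ t → from-e-rec (q (suc k)) (q t) (e-rec (suc k) t)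
  where
  from-e-rec : ∀ κ τ {x₀ x₁ δ} → ERec κ τ x₀ x₁ δ → ShiftRec (q 4 * κ) (q 2 * κ + 1ℚ) κ τ x₀ x₁ δ
  from-e-rec κ τ {x₀} {x₁} {δ} h = combine h (identity κ τ x₀ x₁ δ)
    where
    identity : ∀ κ τ x₀ x₁ δ →
      (((q 4 * κ) - q 2 * τ - (q 2 * κ + 1ℚ)) * x₀)
        - ((1ℚ + τ) * ((q 4 * κ) - q 2 - q 2 * τ) * x₁ + κ * δ)
        ≡ ((q 2 * κ - q 2 * τ - 1ℚ) * x₀) - (q 2 * (1ℚ + τ) * (q 2 * κ - τ - 1ℚ) * x₁ + κ * δ)
    identity = solve 5 (λ κ τ x₀ x₁ δ →
        ((Κ (q 4) :* κ :+ ⊝ (Κ (q 2) :* τ) :+ ⊝ (Κ (q 2) :* κ :+ Κ 1ℚ)) :* x₀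
          :+ ⊝ ((Κ 1ℚ :+ τ) :* (Κ (q 4) :* κ :+ ⊝ Κ (q 2) :+ ⊝ (Κ (q 2) :* τ)) :* x₁ :+ κ :* δ))
      ⊜ ((Κ (q 2) :* κ :+ ⊝ (Κ (q 2) :* τ) :+ ⊝ Κ 1ℚ) :* x₀
          :+ ⊝ (Κ (q 2) :* (Κ 1ℚ :+ τ) :* (Κ (q 2) :* κ :+ ⊝ τ :+ ⊝ Κ 1ℚ) :* x₁ :+ κ :* δ))) refl

oddForm-shift : ∀ K →
  pmulLin (q 2) (q 4 * q K + q 2) (oddForm K)
    ≈ padd (pmulLin (q 2) (q 2 * q K + 1ℚ) (pshift1 (oddForm K))) (pscale (q 2 * q K + 1ℚ) (prodFrom 1 K))
oddForm-shift K = begin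
  pmulLin (q 2) (q 4 * q K + q 2) (oddForm K)
    ≈⟨ pmulLin-cong (q 2) (q 4 * q K + q 2) (oddForm-rising K) ⟩
  pmulLin (q 2) (q 4 * q K + q 2) (rising 0 (O K))
    ≈⟨ shifted-identity _ _ _ K (O K) (λ t → from-o-rec (q K) (q t) (o-rec K t)) ⟩
  padd (pmulLin (q 2) (q 2 * q K + 1ℚ) (pshift1 (rising 0 (O K)))) (pscale (q 2 * q K + 1ℚ) (prodFrom 1 K))
    ≈⟨ padd-cong (pmulLin-cong (q 2) (q 2 * q K + 1ℚ) (pshift1-cong (≈-sym (oddForm-rising K))))
                 (≈-refl {pscale (q 2 * q K + 1ℚ) (prodFrom 1 K)}) ⟩
  padd (pmulLin (q 2) (q 2 * q K + 1ℚ) (pshift1 (oddForm K))) (pscale (q 2 * q K + 1ℚ) (prodFrom 1 K)) ∎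
  where
  open ≈-Reasoning
  from-o-rec : ∀ κ τ {x₀ x₁ δ} → ORec κ τ x₀ x₁ δ → ShiftRec (q 4 * κ + q 2) (q 2 * κ + 1ℚ) (q 2 * κ + 1ℚ) τ x₀ x₁ δ
  from-o-rec κ τ {x₀} {x₁} {δ} h = combine h (identity κ τ x₀ x₁ δ)
    where
    identity : ∀ κ τ x₀ x₁ δ →
      (((q 4 * κ + q 2) - q 2 * τ - (q 2 * κ + 1ℚ)) * x₀)
        - ((1ℚ + τ) * ((q 4 * κ + q 2) - q 2 - q 2 * τ) * x₁ + (q 2 * κ + 1ℚ) * δ)
        ≡ ((q 2 * κ - q 2 * τ + 1ℚ) * x₀)
          - (q 2 * (1ℚ + τ) * (q 2 * κ - τ) * x₁ + (q 2 * κ + 1ℚ) * δ)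
    identity = solve 5 (λ κ τ x₀ x₁ δ →
        ((Κ (q 4) :* κ :+ Κ (q 2) :+ ⊝ (Κ (q 2) :* τ) :+ ⊝ (Κ (q 2) :* κ :+ Κ 1ℚ)) :* x₀
          :+ ⊝ ((Κ 1ℚ :+ τ) :* (Κ (q 4) :* κ :+ Κ (q 2) :+ ⊝ Κ (q 2) :+ ⊝ (Κ (q 2) :* τ)) :* x₁ :+ (Κ (q 2) :* κ :+ Κ 1ℚ) :* δ))
      ⊜ ((Κ (q 2) :* κ :+ ⊝ (Κ (q 2) :* τ) :+ Κ 1ℚ) :* x₀
          :+ ⊝ (Κ (q 2) :* (Κ 1ℚ :+ τ) :* (Κ (q 2) :* κ :+ ⊝ τ) :* x₁ :+ (Κ (q 2) :* κ :+ Κ 1ℚ) :* δ))) refl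

odd-to-even-coeffs : ∀ K → let γ = q 2 * q K + 1ℚ in
  padd (mulLinBasis 0 1ℚ γ (O K)) (unit (suc K)) ≈ mulLinBasis 0 (q 2) γ (E (suc K))
odd-to-even-coeffs K = coeffwise λ t → begin
  coeff (padd (mulLinBasis 0 1ℚ γ (O K)) (unit (suc K))) t
    ≡⟨ trans (coeff-padd (mulLinBasis 0 1ℚ γ (O K)) (unit (suc K)) t)
             (cong (_+ coeff (unit (suc K)) t) (coeff-mulLinBasis 0 1ℚ γ (O K) t)) ⟩
  1ℚ * (coeff (0ℚ ∷ O K) t - q t * coeff (O K) t) + γ * coeff (O K) t + coeff (unit (suc K)) t
    ≡⟨ q-cancelˡ (2 ℕ.* K) (algebra (q (suc (2 ℕ.* K))) (q K) (q t) (coeff (0ℚ ∷ O K) t) (coeff (O K) t)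
                                      (coeff (0ℚ ∷ E (suc K)) t) (coeff (E (suc K)) t) (coeff (unit (suc K)) t)
                                      (trans (q-suc (2 ℕ.* K)) (cong (_+_ 1ℚ) (q-* 2 K)))
                                      (o-e-rec′ K t) (o-e-rec K t) (o-rec′ K t)) ⟩
  q 2 * (coeff (0ℚ ∷ E (suc K)) t - q t * coeff (E (suc K)) t) + γ * coeff (E (suc K)) t
    ≡⟨ coeff-mulLinBasis 0 (q 2) γ (E (suc K)) t ⟨
  coeff (mulLinBasis 0 (q 2) γ (E (suc K))) t ∎
  where
  open ≡-Reasoning
  γ = q 2 * q K + 1ℚ
  algebra : ∀ c κ τ p b p′ a δ → c ≡ 1ℚ + q 2 * κ → OERec′ κ τ p p′ → OERec κ τ b a → ORec′ κ τ p b δ →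
    c * (1ℚ * (p - τ * b) + (q 2 * κ + 1ℚ) * b + δ) ≡ c * (q 2 * (p′ - τ * a) + (q 2 * κ + 1ℚ) * a)
  algebra _ κ τ p b p′ a δ refl h₁ h₀ h =
    combine (q 2 ⊙ h₁ ⊕ q 2 * κ + 1ℚ - q 2 * τ ⊙ h₀ ⊕ - 1ℚ ⊙ h) (identity κ τ p b p′ a δ)
    where
    identity : ∀ κ τ p b p′ a δ →
      ((1ℚ + q 2 * κ) * (1ℚ * (p - τ * b) + (q 2 * κ + 1ℚ) * b + δ))
        - ((1ℚ + q 2 * κ) * (q 2 * (p′ - τ * a) + (q 2 * κ + 1ℚ) * a))
        ≡ (q 2 * ((q 2 * κ + q 2 - τ) * p) + (q 2 * κ + 1ℚ - q 2 * τ) * ((q 2 * κ + 1ℚ - τ) * b) + (- 1ℚ) * ((q 2 * κ - q 2 * τ + q 3) * p))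
          - (q 2 * ((q 2 * κ + 1ℚ) * p′) + (q 2 * κ + 1ℚ - q 2 * τ) * ((q 2 * κ + 1ℚ) * a) + (- 1ℚ) * (q 2 * τ * (q 2 * κ + 1ℚ - τ) * b + (q 2 * κ + 1ℚ) * δ))
    identity = solve 7 (λ κ τ p b p′ a δ →
        ((Κ 1ℚ :+ Κ (q 2) :* κ) :* (Κ 1ℚ :* (p :+ ⊝ (τ :* b)) :+ (Κ (q 2) :* κ :+ Κ 1ℚ) :* b :+ δ)
          :+ ⊝ ((Κ 1ℚ :+ Κ (q 2) :* κ) :* (Κ (q 2) :* (p′ :+ ⊝ (τ :* a)) :+ (Κ (q 2) :* κ :+ Κ 1ℚ) :* a)))
      ⊜ (Κ (q 2) :* ((Κ (q 2) :* κ :+ Κ (q 2) :+ ⊝ τ) :* p)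
          :+ (Κ (q 2) :* κ :+ Κ 1ℚ :+ ⊝ (Κ (q 2) :* τ)) :* ((Κ (q 2) :* κ :+ Κ 1ℚ :+ ⊝ τ) :* b)
          :+ ⊝ Κ 1ℚ :* ((Κ (q 2) :* κ :+ ⊝ (Κ (q 2) :* τ) :+ Κ (q 3)) :* p)
          :+ ⊝ (Κ (q 2) :* ((Κ (q 2) :* κ :+ Κ 1ℚ) :* p′) :+ (Κ (q 2) :* κ :+ Κ 1ℚ :+ ⊝ (Κ (q 2) :* τ)) :* ((Κ (q 2) :* κ :+ Κ 1ℚ) :* a) :+ ⊝ Κ 1ℚ :* (Κ (q 2) :* τ :* (Κ (q 2) :* κ :+ Κ 1ℚ :+ ⊝ τ) :* b :+ (Κ (q 2) :* κ :+ Κ 1ℚ) :* δ)))) refl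

odd-to-even : ∀ K → let γ = q 2 * q K + 1ℚ in
  padd (pmulLin 1ℚ γ (oddForm K)) (prodFrom 0 (suc K)) ≈ pmulLin (q 2) γ (evenForm (suc K))
odd-to-even K = begin
  padd (pmulLin 1ℚ γ (oddForm K)) (prodFrom 0 (suc K))
    ≈⟨ padd-cong (≈-trans (pmulLin-cong 1ℚ γ (oddForm-rising K)) (rising-pmulLin 0 1ℚ γ (O K)))
                 (≈-sym (rising-unit 0 (suc K))) ⟩
  padd (rising 0 (mulLinBasis 0 1ℚ γ (O K))) (rising 0 (unit (suc K)))
    ≈⟨ rising-padd 0 (mulLinBasis 0 1ℚ γ (O K)) (unit (suc K)) ⟨
  rising 0 (padd (mulLinBasis 0 1ℚ γ (O K)) (unit (suc K)))
    ≈⟨ rising-cong 0 (odd-to-even-coeffs K) ⟩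
  rising 0 (mulLinBasis 0 (q 2) γ (E (suc K)))
    ≈⟨ rising-pmulLin 0 (q 2) γ (E (suc K)) ⟨
  pmulLin (q 2) γ (evenForm (suc K)) ∎
  where
  open ≈-Reasoning
  γ = q 2 * q K + 1ℚ

isOdd-double : ∀ k → isOdd (2 ℕ.* k) ≡ false
isOdd-double zero    = refl
isOdd-double (suc k) =
  trans (cong isOdd (ℕP.*-suc 2 k)) (trans (not-involutive (isOdd (2 ℕ.* k))) (isOdd-double k))

half-double : ∀ k → ⌊ 2 ℕ.* k /2⌋ ≡ k
half-double k = sym (trans (ℕP.n≡⌊n+n/2⌋ k) (cong ⌊_/2⌋ (cong (k ℕ.+_) (sym (ℕP.+-identityʳ k)))))

evenBranch : ℕ → Poly → Poly
evenBranch n p = pscale (+ 1 / 4) (padd (pmulLin (q 4) (q (4 ℕ.* n)) p)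
                                  (padd (pmulLin (q 4) (q (2 ℕ.* suc n)) (pshift1 p)) (pmulLin (q 4) (q n) (ell (ℕ.pred n)))))

oddBranch : ℕ → Poly → Poly
oddBranch n p = pscale (+ 1 / 8) (pdivLin (+ n / 2) (padd (pmulLin (q 2) (q (2 ℕ.* n)) p)
                                                    (padd (pmulLin (q 2) (q n) (pshift1 p)) (pmulLin (q 4) (q n) (ell n)))))

step-even : ∀ k p → step (suc (suc (2 ℕ.* k))) p ≡ evenBranch (suc (suc (2 ℕ.* k))) p
step-even k p = cong (λ b → if b then oddBranch n p else evenBranch n p)
                     (trans (not-involutive (isOdd (2 ℕ.* k))) (isOdd-double k))
  where n = suc (suc (2 ℕ.* k))

step-odd : ∀ k p → step (suc (suc (suc (2 ℕ.* k)))) p ≡ oddBranch (suc (suc (suc (2 ℕ.* k)))) p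
step-odd k p = cong (λ b → if b then oddBranch n p else evenBranch n p)
                    (cong not (trans (not-involutive (isOdd (2 ℕ.* k))) (isOdd-double k)))
  where n = suc (suc (suc (2 ℕ.* k)))

shift-identity-coeff : ∀ α β γ δ c X Y Z → pmulLin α β X ≈ padd (pmulLin γ δ Y) (pscale c Z) →
  ∀ j → α * coeff (0ℚ ∷ X) j + β * coeff X j ≡ (γ * coeff (0ℚ ∷ Y) j + δ * coeff Y j) + c * coeff Z j
shift-identity-coeff α β γ δ c X Y Z X≈ j = begin
  α * coeff (0ℚ ∷ X) j + β * coeff X j          ≡⟨ coeff-pmulLin α β X j ⟨
  coeff (pmulLin α β X) j                       ≡⟨ coeff-≡ X≈ j ⟩
  coeff (padd (pmulLin γ δ Y) (pscale c Z)) j  ≡⟨ coeff-padd (pmulLin γ δ Y) (pscale c Z) j ⟩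
  coeff (pmulLin γ δ Y) j + coeff (pscale c Z) j
    ≡⟨ cong₂ _+_ (coeff-pmulLin γ δ Y j) (coeff-pscale c Z j) ⟩
  (γ * coeff (0ℚ ∷ Y) j + δ * coeff Y j) + c * coeff Z j ∎
  where open ≡-Reasoning

even-branch-coeff : ∀ k j → let K = suc k ; n = suc (suc (2 ℕ.* k)) ; A = evenForm K ; S = pshift1 A ; ℓ = prodFrom 1 k in
  coeff (pscale (+ 1 / 4) (padd (pmulLin (q 4) (q (4 ℕ.* n)) A) (padd (pmulLin (q 4) (q (2 ℕ.* suc n)) S) (pmulLin (q 4) (q n) ℓ)))) j
    ≡ coeff (oddForm K) j
even-branch-coeff k j = begin
  coeff (pscale (+ 1 / 4) (padd (pmulLin (q 4) (q (4 ℕ.* n)) A) (padd (pmulLin (q 4) (q (2 ℕ.* suc n)) S) (pmulLin (q 4) (q n) ℓ)))) j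
    ≡⟨ trans (coeff-pscale (+ 1 / 4) (padd (pmulLin (q 4) (q (4 ℕ.* n)) A) (padd (pmulLin (q 4) (q (2 ℕ.* suc n)) S) (pmulLin (q 4) (q n) ℓ))) j)
             (cong ((+ 1 / 4) *_) (trans (coeff-padd₃ (pmulLin (q 4) (q (4 ℕ.* n)) A) (pmulLin (q 4) (q (2 ℕ.* suc n)) S) (pmulLin (q 4) (q n) ℓ) j)
                (cong₂ _+_ (coeff-pmulLin (q 4) (q (4 ℕ.* n)) A j)
                           (cong₂ _+_ (coeff-pmulLin (q 4) (q (2 ℕ.* suc n)) S j) (coeff-pmulLin (q 4) (q n) ℓ j))))) ⟩
  (+ 1 / 4) * ((q 4 * A′ + q (4 ℕ.* n) * A₀) + ((q 4 * S′ + q (2 ℕ.* suc n) * S₀) + (q 4 * ℓ′ + q n * ℓ₀)))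
    ≡⟨ cong₂ (λ u v → (+ 1 / 4) * ((q 4 * A′ + u * A₀) + ((q 4 * S′ + v * S₀) + (q 4 * ℓ′ + q n * ℓ₀))))
             (q-* 4 n) (trans (q-* 2 (suc n)) (cong (q 2 *_) (q-suc n))) ⟩
  (+ 1 / 4) * ((q 4 * A′ + q 4 * q n * A₀) + ((q 4 * S′ + q 2 * (1ℚ + q n) * S₀) + (q 4 * ℓ′ + q n * ℓ₀)))
    ≡⟨ algebra (q K) (q n) A′ A₀ S′ S₀ ℓ′ ℓ₀ q-n shift ⟩
  (q 2 * A′ + q 4 * q K * A₀) + (1ℚ * ℓ′ + q 0 * ℓ₀)
    ≡⟨ cong (λ u → (q 2 * A′ + u * A₀) + (1ℚ * ℓ′ + q 0 * ℓ₀)) (q-* 4 K) ⟨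
  (q 2 * A′ + q (4 ℕ.* K) * A₀) + (1ℚ * ℓ′ + q 0 * ℓ₀)
    ≡⟨ sym (trans (coeff-padd (pmulLin (q 2) (q (4 ℕ.* K)) A) (prodFrom 0 K) j)
                  (cong₂ _+_ (coeff-pmulLin (q 2) (q (4 ℕ.* K)) A j) (coeff-pmulLin 1ℚ (q 0) ℓ j))) ⟩
  coeff (oddForm K) j ∎
  where
  open ≡-Reasoning
  K = suc k
  n = suc (suc (2 ℕ.* k))
  A = evenForm K
  S = pshift1 A
  ℓ = prodFrom 1 k
  A′ = coeff (0ℚ ∷ A) j
  A₀ = coeff A j
  S′ = coeff (0ℚ ∷ S) j
  S₀ = coeff S j
  ℓ′ = coeff (0ℚ ∷ ℓ) j
  ℓ₀ = coeff ℓ j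
  q-n : q n ≡ q 2 * q K
  q-n = trans (cong q (sym (ℕP.*-suc 2 k))) (q-* 2 K)
  shift : q 2 * A′ + q 4 * q K * A₀ ≡ (q 2 * S′ + (q 2 * q K + 1ℚ) * S₀) + q K * ℓ₀
  shift = shift-identity-coeff (q 2) (q 4 * q K) (q 2) (q 2 * q K + 1ℚ) (q K) A S ℓ (evenForm-shift k) j
  algebra : ∀ κ ν A′ A S′ S ℓ′ ℓ → ν ≡ q 2 * κ →
    q 2 * A′ + q 4 * κ * A ≡ (q 2 * S′ + (q 2 * κ + 1ℚ) * S) + κ * ℓ →
    (+ 1 / 4) * ((q 4 * A′ + q 4 * ν * A) + ((q 4 * S′ + q 2 * (1ℚ + ν) * S) + (q 4 * ℓ′ + ν * ℓ)))
      ≡ (q 2 * A′ + q 4 * κ * A) + (1ℚ * ℓ′ + q 0 * ℓ)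
  algebra κ _ A′ A S′ S ℓ′ ℓ refl h = combine (- (+ 1 / 2) ⊙ h) (identity κ A′ A S′ S ℓ′ ℓ)
    where
    identity : ∀ κ A′ A S′ S ℓ′ ℓ →
      ((+ 1 / 4) * ((q 4 * A′ + q 4 * (q 2 * κ) * A) + ((q 4 * S′ + q 2 * (1ℚ + (q 2 * κ)) * S) + (q 4 * ℓ′ + (q 2 * κ) * ℓ))))
        - ((q 2 * A′ + q 4 * κ * A) + (1ℚ * ℓ′ + q 0 * ℓ))
        ≡ ((- (+ 1 / 2)) * (q 2 * A′ + q 4 * κ * A))
          - ((- (+ 1 / 2)) * ((q 2 * S′ + (q 2 * κ + 1ℚ) * S) + κ * ℓ))
    identity = solve 7 (λ κ A′ A S′ S ℓ′ ℓ →
        (Κ (+ 1 / 4) :* (Κ (q 4) :* A′ :+ Κ (q 4) :* (Κ (q 2) :* κ) :* A :+ (Κ (q 4) :* S′ :+ Κ (q 2) :* (Κ 1ℚ :+ Κ (q 2) :* κ) :* S :+ (Κ (q 4) :* ℓ′ :+ Κ (q 2) :* κ :* ℓ)))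
          :+ ⊝ (Κ (q 2) :* A′ :+ Κ (q 4) :* κ :* A :+ (Κ 1ℚ :* ℓ′ :+ Κ (q 0) :* ℓ)))
      ⊜ (⊝ Κ (+ 1 / 2) :* (Κ (q 2) :* A′ :+ Κ (q 4) :* κ :* A)
          :+ ⊝ (⊝ Κ (+ 1 / 2) :* (Κ (q 2) :* S′ :+ (Κ (q 2) :* κ :+ Κ 1ℚ) :* S :+ κ :* ℓ)))) refl

even-step : ∀ k {p} → p ≈ evenForm (suc k) → step (suc (suc (2 ℕ.* k))) p ≈ oddForm (suc k)
even-step k {p} p≈A = begin
  step n p
    ≡⟨ step-even k p ⟩
  evenBranch n p
    ≈⟨ pscale-cong (+ 1 / 4) (padd-cong (pmulLin-cong (q 4) (q (4 ℕ.* n)) p≈A)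
         (padd-cong (pmulLin-cong (q 4) (q (2 ℕ.* suc n)) (pshift1-cong p≈A))
                    (≡⇒≈ (cong (λ m → pmulLin (q 4) (q n) (prodFrom 1 m)) (half-double k))))) ⟩
  pscale (+ 1 / 4) (padd (pmulLin (q 4) (q (4 ℕ.* n)) A) (padd (pmulLin (q 4) (q (2 ℕ.* suc n)) (pshift1 A)) (pmulLin (q 4) (q n) (prodFrom 1 k))))
    ≈⟨ coeffwise (even-branch-coeff k) ⟩
  oddForm (suc k) ∎
  where
  open ≈-Reasoning
  n = suc (suc (2 ℕ.* k))
  A = evenForm (suc k)

odd-branch-coeff : ∀ k j → let K = suc k ; n = suc (suc (suc (2 ℕ.* k))) ; B = oddForm K ; S = pshift1 B ; ℓ = prodFrom 1 K in
  coeff (padd (pmulLin (q 2) (q (2 ℕ.* n)) B) (padd (pmulLin (q 2) (q n) S) (pmulLin (q 4) (q n) ℓ))) j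
    ≡ coeff (pmulLin 1ℚ (+ n / 2) (pscale (q 8) (evenForm (suc K)))) j
odd-branch-coeff k j = begin
  coeff (padd (pmulLin (q 2) (q (2 ℕ.* n)) B) (padd (pmulLin (q 2) (q n) S) (pmulLin (q 4) (q n) ℓ))) j
    ≡⟨ trans (coeff-padd₃ (pmulLin (q 2) (q (2 ℕ.* n)) B) (pmulLin (q 2) (q n) S) (pmulLin (q 4) (q n) ℓ) j)
             (cong₂ _+_ (coeff-pmulLin (q 2) (q (2 ℕ.* n)) B j)
                        (cong₂ _+_ (coeff-pmulLin (q 2) (q n) S j) (coeff-pmulLin (q 4) (q n) ℓ j))) ⟩
  (q 2 * B′ + q (2 ℕ.* n) * B₀) + ((q 2 * S′ + q n * S₀) + (q 4 * ℓ′ + q n * ℓ₀))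
    ≡⟨ cong (λ u → (q 2 * B′ + u * B₀) + ((q 2 * S′ + q n * S₀) + (q 4 * ℓ′ + q n * ℓ₀))) (q-* 2 n) ⟩
  (q 2 * B′ + q 2 * q n * B₀) + ((q 2 * S′ + q n * S₀) + (q 4 * ℓ′ + q n * ℓ₀))
    ≡⟨ algebra (q K) (q n) B′ B₀ S′ S₀ ℓ′ ℓ₀ Q′ Q₀ q-n shift to-even ⟩
  1ℚ * (q 8 * Q′) + q n * (+ 1 / 2) * (q 8 * Q₀)
    ≡⟨ cong₂ (λ u v → 1ℚ * u + v * (q 8 * Q₀)) (coeff-shift-pscale (q 8) Q j) (q-half n) ⟨
  1ℚ * coeff (0ℚ ∷ pscale (q 8) Q) j + (+ n / 2) * (q 8 * Q₀)
    ≡⟨ cong (λ u → 1ℚ * coeff (0ℚ ∷ pscale (q 8) Q) j + (+ n / 2) * u) (coeff-pscale (q 8) Q j) ⟨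
  1ℚ * coeff (0ℚ ∷ pscale (q 8) Q) j + (+ n / 2) * coeff (pscale (q 8) Q) j
    ≡⟨ coeff-pmulLin 1ℚ (+ n / 2) (pscale (q 8) Q) j ⟨
  coeff (pmulLin 1ℚ (+ n / 2) (pscale (q 8) Q)) j ∎
  where
  open ≡-Reasoning
  K = suc k
  n = suc (suc (suc (2 ℕ.* k)))
  B = oddForm K
  S = pshift1 B
  ℓ = prodFrom 1 K
  Q = evenForm (suc K)
  B′ = coeff (0ℚ ∷ B) j
  B₀ = coeff B j
  S′ = coeff (0ℚ ∷ S) j
  S₀ = coeff S j
  ℓ′ = coeff (0ℚ ∷ ℓ) j
  ℓ₀ = coeff ℓ j
  Q′ = coeff (0ℚ ∷ Q) j
  Q₀ = coeff Q j
  q-n : q n ≡ q 2 * q K + 1ℚ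
  q-n = trans (cong (λ m → q (suc m)) (sym (ℕP.*-suc 2 k)))
              (trans (q-suc (2 ℕ.* K)) (trans (cong (_+_ 1ℚ) (q-* 2 K)) (ℚP.+-comm 1ℚ (q 2 * q K))))
  shift : q 2 * B′ + (q 4 * q K + q 2) * B₀ ≡ (q 2 * S′ + (q 2 * q K + 1ℚ) * S₀) + (q 2 * q K + 1ℚ) * ℓ₀
  shift = shift-identity-coeff (q 2) (q 4 * q K + q 2) (q 2) (q 2 * q K + 1ℚ) (q 2 * q K + 1ℚ) B S ℓ (oddForm-shift K) j
  to-even : (1ℚ * B′ + (q 2 * q K + 1ℚ) * B₀) + (1ℚ * ℓ′ + q 0 * ℓ₀) ≡ q 2 * Q′ + (q 2 * q K + 1ℚ) * Q₀
  to-even = begin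
    (1ℚ * B′ + (q 2 * q K + 1ℚ) * B₀) + (1ℚ * ℓ′ + q 0 * ℓ₀)
      ≡⟨ sym (trans (coeff-padd (pmulLin 1ℚ (q 2 * q K + 1ℚ) B) (prodFrom 0 (suc K)) j)
                    (cong₂ _+_ (coeff-pmulLin 1ℚ (q 2 * q K + 1ℚ) B j) (coeff-pmulLin 1ℚ (q 0) ℓ j))) ⟩
    coeff (padd (pmulLin 1ℚ (q 2 * q K + 1ℚ) B) (prodFrom 0 (suc K))) j
      ≡⟨ coeff-≡ (odd-to-even K) j ⟩
    coeff (pmulLin (q 2) (q 2 * q K + 1ℚ) Q) j
      ≡⟨ coeff-pmulLin (q 2) (q 2 * q K + 1ℚ) Q j ⟩
    q 2 * Q′ + (q 2 * q K + 1ℚ) * Q₀ ∎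
  algebra : ∀ κ ν B′ B S′ S ℓ′ ℓ Q′ Q → ν ≡ q 2 * κ + 1ℚ →
    q 2 * B′ + (q 4 * κ + q 2) * B ≡ (q 2 * S′ + (q 2 * κ + 1ℚ) * S) + (q 2 * κ + 1ℚ) * ℓ →
    (1ℚ * B′ + (q 2 * κ + 1ℚ) * B) + (1ℚ * ℓ′ + q 0 * ℓ) ≡ q 2 * Q′ + (q 2 * κ + 1ℚ) * Q →
    (q 2 * B′ + q 2 * ν * B) + ((q 2 * S′ + ν * S) + (q 4 * ℓ′ + ν * ℓ)) ≡ 1ℚ * (q 8 * Q′) + ν * (+ 1 / 2) * (q 8 * Q)
  algebra κ _ B′ B S′ S ℓ′ ℓ Q′ Q refl h₁ h₂ =
    combine (- 1ℚ ⊙ h₁ ⊕ q 4 ⊙ h₂) (identity κ B′ B S′ S ℓ′ ℓ Q′ Q)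
    where
    identity : ∀ κ B′ B S′ S ℓ′ ℓ Q′ Q →
      ((q 2 * B′ + q 2 * (q 2 * κ + 1ℚ) * B) + ((q 2 * S′ + (q 2 * κ + 1ℚ) * S) + (q 4 * ℓ′ + (q 2 * κ + 1ℚ) * ℓ)))
        - (1ℚ * (q 8 * Q′) + (q 2 * κ + 1ℚ) * (+ 1 / 2) * (q 8 * Q))
        ≡ ((- 1ℚ) * (q 2 * B′ + (q 4 * κ + q 2) * B) + q 4 * ((1ℚ * B′ + (q 2 * κ + 1ℚ) * B) + (1ℚ * ℓ′ + q 0 * ℓ)))
          - ((- 1ℚ) * ((q 2 * S′ + (q 2 * κ + 1ℚ) * S) + (q 2 * κ + 1ℚ) * ℓ) + q 4 * (q 2 * Q′ + (q 2 * κ + 1ℚ) * Q))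
    identity = solve 9 (λ κ B′ B S′ S ℓ′ ℓ Q′ Q →
        (Κ (q 2) :* B′ :+ Κ (q 2) :* (Κ (q 2) :* κ :+ Κ 1ℚ) :* B
          :+ (Κ (q 2) :* S′ :+ (Κ (q 2) :* κ :+ Κ 1ℚ) :* S :+ (Κ (q 4) :* ℓ′ :+ (Κ (q 2) :* κ :+ Κ 1ℚ) :* ℓ))
          :+ ⊝ (Κ 1ℚ :* (Κ (q 8) :* Q′) :+ (Κ (q 2) :* κ :+ Κ 1ℚ) :* Κ (+ 1 / 2) :* (Κ (q 8) :* Q)))
      ⊜ (⊝ Κ 1ℚ :* (Κ (q 2) :* B′ :+ (Κ (q 4) :* κ :+ Κ (q 2)) :* B)
          :+ Κ (q 4) :* (Κ 1ℚ :* B′ :+ (Κ (q 2) :* κ :+ Κ 1ℚ) :* B :+ (Κ 1ℚ :* ℓ′ :+ Κ (q 0) :* ℓ))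
          :+ ⊝ (⊝ Κ 1ℚ :* (Κ (q 2) :* S′ :+ (Κ (q 2) :* κ :+ Κ 1ℚ) :* S :+ (Κ (q 2) :* κ :+ Κ 1ℚ) :* ℓ) :+ Κ (q 4) :* (Κ (q 2) :* Q′ :+ (Κ (q 2) :* κ :+ Κ 1ℚ) :* Q)))) refl

odd-step : ∀ k {p} → p ≈ oddForm (suc k) → step (suc (suc (suc (2 ℕ.* k)))) p ≈ evenForm (suc (suc k))
odd-step k {p} p≈B = begin
  step n p
    ≡⟨ step-odd k p ⟩
  pscale (+ 1 / 8) (pdivLin (+ n / 2) N)
    ≈⟨ pscale-cong (+ 1 / 8) (pdivLin-exact (+ n / 2) (begin
         N
           ≈⟨ padd-cong (pmulLin-cong (q 2) (q (2 ℕ.* n)) p≈B)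
                (padd-cong (pmulLin-cong (q 2) (q n) (pshift1-cong p≈B))
                           (≡⇒≈ (cong (λ m → pmulLin (q 4) (q n) (prodFrom 1 (suc m))) (half-double k)))) ⟩
         padd (pmulLin (q 2) (q (2 ℕ.* n)) B) (padd (pmulLin (q 2) (q n) (pshift1 B)) (pmulLin (q 4) (q n) (prodFrom 1 (suc k))))
           ≈⟨ coeffwise (odd-branch-coeff k) ⟩
         pmulLin 1ℚ (+ n / 2) (pscale (q 8) Q) ∎)) ⟩
  pscale (+ 1 / 8) (pscale (q 8) Q)
    ≈⟨ coeffwise (λ j → trans (coeff-pscale (+ 1 / 8) (pscale (q 8) Q) j)
                              (trans (cong (_*_ (+ 1 / 8)) (coeff-pscale (q 8) Q j)) (eighth (coeff Q j)))) ⟩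
  Q ∎
  where
  open ≈-Reasoning
  n = suc (suc (suc (2 ℕ.* k)))
  B = oddForm (suc k)
  Q = evenForm (suc (suc k))
  N = padd (pmulLin (q 2) (q (2 ℕ.* n)) p) (padd (pmulLin (q 2) (q n) (pshift1 p)) (pmulLin (q 4) (q n) (ell n)))
  eighth : ∀ x → (+ 1 / 8) * (q 8 * x) ≡ x
  eighth = solve 1 (λ x → (Κ (+ 1 / 8) :* (Κ (q 8) :* x)) ⊜ (x)) refl

P-evenForm : ∀ k → P (suc (suc (2 ℕ.* k))) ≈ evenForm (suc k)
P-oddForm : ∀ k → P (suc (suc (suc (2 ℕ.* k)))) ≈ oddForm (suc k)

P-evenForm zero    = ≈-sym (≈-trans (rising-single 0 (coeffE 0 0)) (≡⇒≈ (cong (_∷ []) (coeffE-zero 0))))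
P-evenForm (suc k) = ≈-trans (≡⇒≈ (cong (λ m → P (suc (suc m))) (ℕP.*-suc 2 k))) (odd-step k (P-oddForm k))
P-oddForm k        = even-step k (P-evenForm k)

-- Parity

Integral : ℚ → Set
Integral x = Σ ℤ λ z → x ≡ z / 1

-- Matches `_≡₂_`: x ≡₂ y is Even (x - y).
Even : ℚ → Set
Even x = Σ ℤ λ z → x ≡ (+ 2 ℤ.* z) / 1

integral-+ : ∀ {x y} → Integral x → Integral y → Integral (x + y)
integral-+ (a , refl) (b , refl) = a ℤ.+ b , sym (ι-+ a b)

integral-* : ∀ {x y} → Integral x → Integral y → Integral (x * y)
integral-* (a , refl) (b , refl) = a ℤ.* b , sym (ι-* a b)

integral-neg : ∀ {x} → Integral x → Integral (- x)
integral-neg (a , refl) = ℤ.- a , (begin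
  - ι a                    ≡⟨ negate (ι a) ⟩
  ι (ℤ.- + 1) * ι a        ≡⟨ ι-* (ℤ.- + 1) a ⟨
  ι (ℤ.- + 1 ℤ.* a)        ≡⟨ cong ι (ℤP.-1*i≡-i a) ⟩
  ι (ℤ.- a) ∎)
  where
  open ≡-Reasoning
  negate : ∀ x → - x ≡ ι (ℤ.- + 1) * x
  negate x = trans (cong -_ (sym (ℚP.*-identityˡ x))) (ℚP.neg-distribˡ-* 1ℚ x)

integral-q : ∀ n → Integral (q n)
integral-q n = + n , refl

even-+ : ∀ {x y} → Even x → Even y → Even (x + y)
even-+ (a , refl) (b , refl) = a ℤ.+ b , trans (sym (ι-+ (+ 2 ℤ.* a) (+ 2 ℤ.* b))) (cong ι (sym (ℤP.*-distribˡ-+ (+ 2) a b)))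

even-* : ∀ {x y} → Integral x → Even y → Even (x * y)
even-* (a , refl) (b , refl) = a ℤ.* b , trans (sym (ι-* a (+ 2 ℤ.* b))) (cong ι (swap a b))
  where
  swap : ∀ a b → a ℤ.* (+ 2 ℤ.* b) ≡ + 2 ℤ.* (a ℤ.* b)
  swap = ℤSolver.solve-∀

even-double : ∀ {x} → Integral x → Even (q 2 * x)
even-double (a , refl) = a , sym (ι-* (+ 2) a)

even-resp : ∀ {x y} → x ≡ y → Even y → Even x
even-resp refl even = even

even-0 : Even 0ℚ
even-0 = + 0 , refl

even-coeff-∷ : ∀ {h p} → Even h → (∀ j → Even (coeff p j)) → ∀ j → Even (coeff (h ∷ p) j)
even-coeff-∷ even-h even-p zero    = even-h
even-coeff-∷ even-h even-p (suc j) = even-p j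

rising-even : ∀ a L → (∀ t → Even (coeff L t)) → ∀ j → Even (coeff (rising a L) j)
rising-even a []       even-L j = even-0
rising-even a (h ∷ hs) even-L j =
  even-resp (trans (coeff-padd (h ∷ []) (pmulLin 1ℚ (q a) R) j) (cong (_+_ (coeff (h ∷ []) j)) (coeff-pmulLin 1ℚ (q a) R j)))
    (even-+ (even-coeff-∷ (even-L 0) (λ _ → even-0) j)
            (even-+ (even-* (integral-q 1) (even-coeff-∷ even-0 even-R j)) (even-* (integral-q a) (even-R j))))
  where
  R = rising (suc a) hs
  even-R : ∀ j → Even (coeff R j)
  even-R = rising-even (suc a) hs (λ t → even-L (suc t))

integral-coeffE : ∀ t u → Integral (coeffE t u)
integral-coeffE t u = subst Integral (sym (coeffE-def t u)) (integral-* (integral-* (integral-q (4 ^ u)) (integral-q (u !))) (integral-q ((t ℕ.+ suc (2 ℕ.* u)) C t)))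

integral-antidiagonal : ∀ {f} → (∀ t u → Integral (f t u)) → ∀ n j → Integral (coeff (antidiagonal f n) j)
integral-antidiagonal integral-f zero    j       = integral-q 0
integral-antidiagonal integral-f (suc n) zero    = integral-f 0 n
integral-antidiagonal integral-f (suc n) (suc j) = integral-antidiagonal (λ t → integral-f (suc t)) n j

integral-E : ∀ K j → Integral (coeff (E K) j)
integral-E = integral-antidiagonal integral-coeffE

integral-unit : ∀ k j → Integral (coeff (unit k) j)
integral-unit zero    zero    = integral-q 1
integral-unit zero    (suc j) = integral-q 0
integral-unit (suc k) zero    = integral-q 0
integral-unit (suc k) (suc j) = integral-unit k j

integral-shift : ∀ {L} → (∀ j → Integral (coeff L j)) → ∀ j → Integral (coeff (0ℚ ∷ L) j)
integral-shift integral-L zero    = integral-q 0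
integral-shift integral-L (suc j) = integral-L j

even-coeffE : ∀ t u → Even (coeffE t (suc u))
even-coeffE t u = even-resp (trans (coeffE-def t (suc u)) (cong (λ x → x * q (suc u !) * q ((t ℕ.+ suc (2 ℕ.* suc u)) C t)) (trans (cong q (ℕP.*-assoc 2 2 (4 ^ u))) (q-* 2 (2 ℕ.* 4 ^ u)))))
  (even-resp (regroup (q (2 ℕ.* 4 ^ u)) (q (suc u !)) (q ((t ℕ.+ suc (2 ℕ.* suc u)) C t)))
    (even-double (integral-* (integral-* (integral-q (2 ℕ.* 4 ^ u)) (integral-q (suc u !))) (integral-q ((t ℕ.+ suc (2 ℕ.* suc u)) C t)))))
  where
  regroup : ∀ a b c → q 2 * a * b * c ≡ q 2 * (a * b * c)
  regroup = solve 3 (λ a b c → (Κ (q 2) :* a :* b :* c) ⊜ (Κ (q 2) :* (a :* b :* c))) refl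

E-even-below-top-by : ∀ m t → ℕ.Ordering t (suc m) → Even (coeff (E (suc (suc m))) t - q (suc (suc m)) * coeff (unit (suc m)) t)
E-even-below-top-by .(t ℕ.+ u) t (ℕ.less .t u) = even-resp
  (trans (cong₂ (λ x δ → x - q (suc (suc (t ℕ.+ u))) * δ)
                (coeff-antidiagonal coeffE t (suc u) (cong suc (sym (ℕP.+-suc t u))))
                (coeff-unit-< {suc (t ℕ.+ u)} {t} (s≤s (ℕP.m≤m+n t u))))
         (drop (coeffE t (suc u)) (q (suc (suc (t ℕ.+ u))))))
  (even-coeffE t u)
  where
  drop : ∀ x κ → x - κ * 0ℚ ≡ x
  drop = solve 2 (λ x κ → (x :+ ⊝ (κ :* Κ 0ℚ)) ⊜ (x)) refl
E-even-below-top-by m .(suc m) (ℕ.equal .(suc m)) = even-resp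
  (trans (cong₂ (λ x δ → x - q (suc (suc m)) * δ)
                (trans (coeff-antidiagonal coeffE (suc m) 0 (cong suc (sym (ℕP.+-identityʳ (suc m))))) (coeffE-zero (suc m)))
                (coeff-unit-self (suc m)))
         (cancel (q (suc m)) (q (suc (suc m))) (q-suc (suc m))))
  even-0
  where
  cancel : ∀ τ κ → κ ≡ 1ℚ + τ → (1ℚ + τ) - κ * 1ℚ ≡ 0ℚ
  cancel τ _ refl = solve 1 (λ τ → (Κ 1ℚ :+ τ :+ ⊝ ((Κ 1ℚ :+ τ) :* Κ 1ℚ)) ⊜ (Κ 0ℚ)) refl τ
E-even-below-top-by m .(suc (suc (m ℕ.+ k))) (ℕ.greater .(suc m) k) = even-resp
  (trans (cong₂ (λ x δ → x - q (suc (suc m)) * δ) (E-≥ (suc (suc m)) t (s≤s (s≤s (ℕP.m≤m+n m k))))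
                                                  (coeff-unit-> {suc m} {t} (s≤s (s≤s (ℕP.m≤m+n m k)))))
         (vanish (q (suc (suc m)))))
  even-0
  where
  t = suc (suc (m ℕ.+ k))
  vanish : ∀ κ → 0ℚ - κ * 0ℚ ≡ 0ℚ
  vanish = solve 1 (λ κ → (Κ 0ℚ :+ ⊝ (κ :* Κ 0ℚ)) ⊜ (Κ 0ℚ)) refl

E-even-below-top : ∀ m t → Even (coeff (E (suc (suc m))) t - q (suc (suc m)) * coeff (unit (suc m)) t)
E-even-below-top m t = E-even-below-top-by m t (ℕ.compare t (suc m))

coeff-difference : ∀ c a {X Y} L M → X ≈ rising a L → Y ≈ rising a M →
  ∀ j → coeff X j - c * coeff Y j ≡ coeff (rising a (padd L (pscale (- c) M))) j
coeff-difference c a {X} {Y} L M X≈ Y≈ j = begin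
  coeff X j - c * coeff Y j
    ≡⟨ negate (coeff X j) c (coeff Y j) ⟩
  coeff X j + (- c) * coeff Y j
    ≡⟨ sym (trans (coeff-padd X (pscale (- c) Y) j) (cong (_+_ (coeff X j)) (coeff-pscale (- c) Y j))) ⟩
  coeff (padd X (pscale (- c) Y)) j
    ≡⟨ coeff-≡ (padd-cong X≈ (pscale-cong (- c) Y≈)) j ⟩
  coeff (padd (rising a L) (pscale (- c) (rising a M))) j
    ≡⟨ coeff-≡ (padd-cong (≈-refl {rising a L}) (≈-sym (rising-pscale a (- c) M))) j ⟩
  coeff (padd (rising a L) (rising a (pscale (- c) M))) j
    ≡⟨ coeff-≡ (rising-padd a L (pscale (- c) M)) j ⟨
  coeff (rising a (padd L (pscale (- c) M))) j ∎
  where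
  open ≡-Reasoning
  negate : ∀ x c y → x - c * y ≡ x + (- c) * y
  negate = solve 3 (λ x c y → (x :+ ⊝ (c :* y)) ⊜ (x :+ ⊝ c :* y)) refl

pmulLin-prodFrom : ∀ α β k → pmulLin α β (prodFrom 0 k) ≈ rising 0 (mulLinBasis 0 α β (unit k))
pmulLin-prodFrom α β k = ≈-trans (pmulLin-cong α β (≈-sym (rising-unit 0 k))) (rising-pmulLin 0 α β (unit k))

r-polynomial : ∀ m → let n = 2 ℕ.* suc (suc m) in
  pmulLin (q 4) (q (3 ℕ.* n ℕ.∸ 4)) (prodFrom 0 (suc ⌊ n ℕ.∸ 4 /2⌋)) ≡ pmulLin (q 4) (q (8 ℕ.+ 6 ℕ.* m)) (prodFrom 0 (suc m))
r-polynomial m = cong₂ (λ c k → pmulLin (q 4) (q c) (prodFrom 0 (suc k)))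
  (trans (cong (ℕ._∸ 4) (shape₁ m)) (ℕP.m+n∸n≡m (8 ℕ.+ 6 ℕ.* m) 4))
  (trans (cong (λ x → ⌊ x ℕ.∸ 4 /2⌋) (shape₂ m)) (trans (cong ⌊_/2⌋ (ℕP.m+n∸n≡m (2 ℕ.* m) 4)) (half-double m)))
  where
  shape₁ : ∀ m → 3 ℕ.* (2 ℕ.* suc (suc m)) ≡ (8 ℕ.+ 6 ℕ.* m) ℕ.+ 4
  shape₁ = ℕSolver.solve-∀
  shape₂ : ∀ m → 2 ℕ.* suc (suc m) ≡ 2 ℕ.* m ℕ.+ 4
  shape₂ = ℕSolver.solve-∀

s-polynomial : ∀ m → let n = suc (2 ℕ.* suc m) in
  pmulLin (q 4) (q (3 ℕ.* n ℕ.∸ 4)) (prodFrom 0 (suc ⌊ n ℕ.∸ 3 /2⌋)) ≡ pmulLin (q 4) (q (5 ℕ.+ 6 ℕ.* m)) (prodFrom 0 (suc m))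
s-polynomial m = cong₂ (λ c k → pmulLin (q 4) (q c) (prodFrom 0 (suc k)))
  (trans (cong (ℕ._∸ 4) (shape₁ m)) (ℕP.m+n∸n≡m (5 ℕ.+ 6 ℕ.* m) 4))
  (trans (cong (λ x → ⌊ x ℕ.∸ 3 /2⌋) (shape₂ m)) (trans (cong ⌊_/2⌋ (ℕP.m+n∸n≡m (2 ℕ.* m) 3)) (half-double m)))
  where
  shape₁ : ∀ m → 3 ℕ.* suc (2 ℕ.* suc m) ≡ (5 ℕ.+ 6 ℕ.* m) ℕ.+ 4
  shape₁ = ℕSolver.solve-∀
  shape₂ : ∀ m → suc (2 ℕ.* suc m) ≡ 2 ℕ.* m ℕ.+ 3
  shape₂ = ℕSolver.solve-∀

-- Coefficients of P_{2(m+2)} - r-polynomial/2 in the basis x(x+1)⋯(x+t-1).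
even-difference : ℕ → Poly
even-difference m = padd (E (suc (suc m))) (pscale (- (+ 1 / 2)) (mulLinBasis 0 (q 4) (q (8 ℕ.+ 6 ℕ.* m)) (unit (suc m))))

even-difference-even : ∀ m t → Even (coeff (even-difference m) t)
even-difference-even m t = even-resp
  (begin
    coeff (even-difference m) t
      ≡⟨ trans (coeff-padd (E K) (pscale (- (+ 1 / 2)) (mulLinBasis 0 (q 4) β (unit (suc m)))) t)
               (cong (_+_ (coeff (E K) t)) (trans (coeff-pscale (- (+ 1 / 2)) (mulLinBasis 0 (q 4) β (unit (suc m))) t)
                                                  (cong (_*_ (- (+ 1 / 2))) (coeff-mulLinBasis 0 (q 4) β (unit (suc m)) t)))) ⟩
    e + (- (+ 1 / 2)) * (q 4 * (δ′ - q t * δ) + β * δ)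
      ≡⟨ cong (λ b → e + (- (+ 1 / 2)) * (q 4 * (δ′ - q t * δ) + b * δ)) (trans (q-+ 8 (6 ℕ.* m)) (cong (_+_ (q 8)) (q-* 6 m))) ⟩
    e + (- (+ 1 / 2)) * (q 4 * (δ′ - q t * δ) + (q 8 + q 6 * q m) * δ)
      ≡⟨ algebra (q m) (q (suc m)) (q K) (q t) e δ δ′ (q-suc m) (q-suc (suc m)) ⟩
    ((e - q K * δ) + q 2 * ((q t - q (suc m)) * δ)) + q 2 * (- δ′) ∎)
  (even-+ (even-+ (E-even-below-top m t)
                  (even-double (integral-* (integral-+ (integral-q t) (integral-neg (integral-q (suc m)))) (integral-unit (suc m) t))))
          (even-double (integral-neg (integral-unit K t))))
  where
  open ≡-Reasoning
  K = suc (suc m)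
  β = q (8 ℕ.+ 6 ℕ.* m)
  e = coeff (E K) t
  δ = coeff (unit (suc m)) t
  δ′ = coeff (unit K) t
  algebra : ∀ μ ν κ τ e δ δ′ → ν ≡ 1ℚ + μ → κ ≡ 1ℚ + ν →
    e + (- (+ 1 / 2)) * (q 4 * (δ′ - τ * δ) + (q 8 + q 6 * μ) * δ) ≡ ((e - κ * δ) + q 2 * ((τ - ν) * δ)) + q 2 * (- δ′)
  algebra μ _ _ τ e δ δ′ refl refl =
    solve 5 (λ μ τ e δ δ′ →
          (e :+ ⊝ Κ (+ 1 / 2) :* (Κ (q 4) :* (δ′ :+ ⊝ (τ :* δ)) :+ (Κ (q 8) :+ Κ (q 6) :* μ) :* δ))
        ⊜ (e :+ ⊝ ((Κ 1ℚ :+ (Κ 1ℚ :+ μ)) :* δ) :+ Κ (q 2) :* ((τ :+ ⊝ (Κ 1ℚ :+ μ)) :* δ)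
            :+ Κ (q 2) :* ⊝ δ′)) refl μ τ e δ δ′

even-parity : ∀ m j → let n = 2 ℕ.* suc (suc m) in
  Even (coeff (P n) j - (+ 1 / 2) * coeff (pmulLin (q 4) (q (3 ℕ.* n ℕ.∸ 4)) (prodFrom 0 (suc ⌊ n ℕ.∸ 4 /2⌋))) j)
even-parity m j = even-resp
  (begin
    coeff (P n) j - (+ 1 / 2) * coeff (pmulLin (q 4) (q (3 ℕ.* n ℕ.∸ 4)) (prodFrom 0 (suc ⌊ n ℕ.∸ 4 /2⌋))) j
      ≡⟨ cong₂ (λ x y → x - (+ 1 / 2) * y) (coeff-≡ P≈evenForm j) (cong (λ R → coeff R j) (r-polynomial m)) ⟩
    coeff (evenForm K) j - (+ 1 / 2) * coeff (pmulLin (q 4) β (prodFrom 0 (suc m))) j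
      ≡⟨ coeff-difference (+ 1 / 2) 0 (E K) (mulLinBasis 0 (q 4) β (unit (suc m))) ≈-refl (pmulLin-prodFrom (q 4) β (suc m)) j ⟩
    coeff (rising 0 (even-difference m)) j ∎)
  (rising-even 0 (even-difference m) (even-difference-even m) j)
  where
  open ≡-Reasoning
  n = 2 ℕ.* suc (suc m)
  K = suc (suc m)
  β = q (8 ℕ.+ 6 ℕ.* m)
  P≈evenForm : P n ≈ evenForm K
  P≈evenForm = ≈-trans (≡⇒≈ (cong P (ℕP.*-suc 2 (suc m)))) (P-evenForm (suc m))

-- Coefficients of P_{2m+3} - s-polynomial in the basis x(x+1)⋯(x+t-1).
odd-difference : ℕ → Poly
odd-difference m = padd (O (suc m)) (pscale (- 1ℚ) (mulLinBasis 0 (q 4) (q (5 ℕ.+ 6 ℕ.* m)) (unit (suc m))))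

odd-difference-even : ∀ m t → Even (coeff (odd-difference m) t)
odd-difference-even m t = even-resp
  (begin
    coeff (odd-difference m) t
      ≡⟨ trans (coeff-padd (O K) (pscale (- 1ℚ) (mulLinBasis 0 (q 4) β (unit K))) t)
               (cong₂ _+_ (coeff-O K t) (trans (coeff-pscale (- 1ℚ) (mulLinBasis 0 (q 4) β (unit K)) t)
                                               (cong (_*_ (- 1ℚ)) (coeff-mulLinBasis 0 (q 4) β (unit K) t)))) ⟩
    (q 2 * p + q 2 * (q 2 * q K - q t) * e + δ) + (- 1ℚ) * (q 4 * (δ′ - q t * δ) + β * δ)
      ≡⟨ cong (λ b → (q 2 * p + q 2 * (q 2 * q K - q t) * e + δ) + (- 1ℚ) * (q 4 * (δ′ - q t * δ) + b * δ))
              (trans (q-+ 5 (6 ℕ.* m)) (cong (_+_ (q 5)) (q-* 6 m))) ⟩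
    (q 2 * p + q 2 * (q 2 * q K - q t) * e + δ) + (- 1ℚ) * (q 4 * (δ′ - q t * δ) + (q 5 + q 6 * q m) * δ)
      ≡⟨ algebra (q m) (q K) (q t) p e δ δ′ (q-suc m) ⟩
    q 2 * (p + (q 2 * q K - q t) * e - q 2 * δ′ + (q 2 * q t - q 3 * q m - q 2) * δ) ∎)
  (even-double integral)
  where
  open ≡-Reasoning
  K = suc m
  β = q (5 ℕ.+ 6 ℕ.* m)
  p = coeff (0ℚ ∷ E K) t
  e = coeff (E K) t
  δ = coeff (unit K) t
  δ′ = coeff (unit (suc K)) t
  algebra : ∀ μ κ τ p e δ δ′ → κ ≡ 1ℚ + μ →
    (q 2 * p + q 2 * (q 2 * κ - τ) * e + δ) + (- 1ℚ) * (q 4 * (δ′ - τ * δ) + (q 5 + q 6 * μ) * δ)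
      ≡ q 2 * (p + (q 2 * κ - τ) * e - q 2 * δ′ + (q 2 * τ - q 3 * μ - q 2) * δ)
  algebra μ _ τ p e δ δ′ refl =
    solve 6 (λ μ τ p e δ δ′ →
          (Κ (q 2) :* p :+ Κ (q 2) :* (Κ (q 2) :* (Κ 1ℚ :+ μ) :+ ⊝ τ) :* e :+ δ
            :+ ⊝ Κ 1ℚ :* (Κ (q 4) :* (δ′ :+ ⊝ (τ :* δ)) :+ (Κ (q 5) :+ Κ (q 6) :* μ) :* δ))
        ⊜ (Κ (q 2) :* (p :+ (Κ (q 2) :* (Κ 1ℚ :+ μ) :+ ⊝ τ) :* e :+ ⊝ (Κ (q 2) :* δ′) :+ (Κ (q 2) :* τ :+ ⊝ (Κ (q 3) :* μ) :+ ⊝ Κ (q 2)) :* δ))) refl μ τ p e δ δ′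
  integral : Integral (p + (q 2 * q K - q t) * e - q 2 * δ′ + (q 2 * q t - q 3 * q m - q 2) * δ)
  integral =
    integral-+ (integral-+ (integral-+ (integral-shift (integral-E K) t)
                                       (integral-* (integral-+ (integral-* (integral-q 2) (integral-q K)) (integral-neg (integral-q t)))
                                                   (integral-E K t)))
                           (integral-neg (integral-* (integral-q 2) (integral-unit (suc K) t))))
               (integral-* (integral-+ (integral-+ (integral-* (integral-q 2) (integral-q t))
                                                   (integral-neg (integral-* (integral-q 3) (integral-q m))))
                                       (integral-neg (integral-q 2)))
                           (integral-unit K t))

odd-parity : ∀ m j → let n = suc (2 ℕ.* suc m) in
  Even (coeff (P n) j - coeff (pmulLin (q 4) (q (3 ℕ.* n ℕ.∸ 4)) (prodFrom 0 (suc ⌊ n ℕ.∸ 3 /2⌋))) j)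
odd-parity m j = even-resp
  (begin
    coeff (P n) j - coeff (pmulLin (q 4) (q (3 ℕ.* n ℕ.∸ 4)) (prodFrom 0 (suc ⌊ n ℕ.∸ 3 /2⌋))) j
      ≡⟨ cong₂ _-_ (coeff-≡ P≈oddForm j) (trans (cong (λ R → coeff R j) (s-polynomial m)) (sym (ℚP.*-identityˡ _))) ⟩
    coeff (rising 0 (O K)) j - 1ℚ * coeff (pmulLin (q 4) β (prodFrom 0 K)) j
      ≡⟨ coeff-difference 1ℚ 0 (O K) (mulLinBasis 0 (q 4) β (unit K)) ≈-refl (pmulLin-prodFrom (q 4) β K) j ⟩
    coeff (rising 0 (odd-difference m)) j ∎)
  (rising-even 0 (odd-difference m) (odd-difference-even m) j)
  where
  open ≡-Reasoning
  n = suc (2 ℕ.* suc m)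
  K = suc m
  β = q (5 ℕ.+ 6 ℕ.* m)
  P≈oddForm : P n ≈ rising 0 (O K)
  P≈oddForm = ≈-trans (≡⇒≈ (cong (λ x → P (suc x)) (ℕP.*-suc 2 m))) (≈-trans (P-oddForm m) (oddForm-rising K))

proposition2 :
    ((k : ℕ) → 2 ≤ k → (i : ℕ) → i ≤ mOf (2 ℕ.* k) → a i (2 ℕ.* k) ≡₂ r i (2 ℕ.* k))
      × ((k : ℕ) → 1 ≤ k → (i : ℕ) → i ≤ mOf (suc (2 ℕ.* k)) → a i (suc (2 ℕ.* k)) ≡₂ s i (suc (2 ℕ.* k)))
proposition2 = even-case , odd-case
  where
  even-case : (k : ℕ) → 2 ≤ k → (i : ℕ) → i ≤ mOf (2 ℕ.* k) → a i (2 ℕ.* k) ≡₂ r i (2 ℕ.* k)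
  even-case (suc (suc m)) _           i _ = even-parity m (mOf (2 ℕ.* suc (suc m)) ℕ.∸ i)
  even-case (suc zero)    (s≤s ())
  odd-case : (k : ℕ) → 1 ≤ k → (i : ℕ) → i ≤ mOf (suc (2 ℕ.* k)) → a i (suc (2 ℕ.* k)) ≡₂ s i (suc (2 ℕ.* k))
  odd-case (suc m) _ i _ = odd-parity m (mOf (suc (2 ℕ.* suc m)) ℕ.∸ i)
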